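{- Let $p$ be a prime, $d\mid p-1$ with $1<d<p-1$, and $\mu_d$ the set of $d$-th roots of unity in $\mathbb F_p$. Let $A,B\subseteq\mathbb F_p$ with $A+B=\mu_d$, $|A|=\alpha>1$, $|B|=\beta>1$. Then for every $b\in B$, in $\mathbb F_p$, \[\sum_{a\in A}\frac{1}{a+b}=\frac{(\alpha+1)\alpha}{d-1}\sum_{b'\in B\setminus\{b\}}\frac{1}{b-b'}\] and \[\Big(\sum_{a\in A}\frac{1}{a+b}\Big)^2+\sum_{a\in A}\frac{1}{(a+b)^2}=\frac{\alpha(\alpha+1)(\alpha+2)}{(d-1)(d-2)}\Big(\alpha\Big(\sum_{b'\in B\setminus\{b\}}\frac{1}{b-b'}\Big)^2-\sum_{b'\in B\setminus\{b\}}\frac{1}{(b-b')^2}\Big).\] -}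

module Defs where

open import Data.Nat using (ℕ; zero; suc; _+_; _*_; _∸_; _^_; NonZero)
open import Data.Nat.DivMod using (_mod_)
open import Data.Fin using (Fin; toℕ; _≟_)
open import Data.List using (List; foldr; map; filter)
open import Relation.Nullary using (¬?)
open import Relation.Binary.PropositionalEquality using (_≡_)

module _ (p : ℕ) .{{_ : NonZero p}} where

  ι : ℕ → Fin p
  ι n = n mod p

  0F 1F : Fin p
  0F = ι 0
  1F = ι 1

  _+F_ : Fin p → Fin p → Fin p
  x +F y = ι (toℕ x + toℕ y)

  _*F_ : Fin p → Fin p → Fin p
  x *F y = ι (toℕ x * toℕ y)

  -F_ : Fin p → Fin p
  -F x = ι (p ∸ toℕ x)

  _-F_ : Fin p → Fin p → Fin p
  x -F y = x +F (-F y)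

  _^F_ : Fin p → ℕ → Fin p
  x ^F k = ι (toℕ x ^ k)

  sqF : Fin p → Fin p
  sqF x = x *F x

  -- multiplicative inverse in F_p (p prime), via Fermat: x⁻¹ = x^(p-2).
  -- (gives 0⁻¹ = 0, which never matters below since all inverted
  -- quantities are nonzero under the hypotheses)
  invF : Fin p → Fin p
  invF x = x ^F (p ∸ 2)

  sumF : List (Fin p) → Fin p
  sumF = foldr _+F_ 0F

  IsRootOfUnity : ℕ → Fin p → Set
  IsRootOfUnity d x = x ^F d ≡ 1F

  remove : Fin p → List (Fin p) → List (Fin p)
  remove b B = filter (λ b' → ¬? (b' ≟ b)) B

{-# OPTIONS --safe #-}
module Submission where

-- Write C = -A, so that b - c = a + b ∈ μ_d for c ∈ C and b ∈ B, and let α = |C|, β = |B|,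
-- N = d + α - 1. The Lagrange weights w_c = 1 / ∏_{c′ ≠ c} (c - c′) satisfy Σ_c w_c f(c) = [x^(α-1)] f
-- whenever deg f < α, so
--   G(x) = Σ_c w_c (x - c)ᴺ - (-1)^(α-1)
-- has degree d, and its j-th Taylor coefficient at b ∈ B is binom(N, j) Σ_c w_c (b - c)^(N-j), which
-- vanishes for j < α because (b - c)ᵈ = 1. Counting roots gives αβ ≤ d, and A + B = μ_d gives d ≤ αβ,
-- so G = κ ∏_{b′ ∈ B} (x - b′)^α. At b, the Taylor coefficients of order α, α + 1, α + 2 are
-- binom(N, α - 1 + k) M_k on the left, with M_k = Σ_c w_c (b - c)^(-k), and κ times expressions in
-- T1, T2 on the right; dividing ∏_c (x - c) repeatedly by x - b expresses M_1, M_2, M_3 through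
-- S1, S2. Eliminating κ and the M_k with the ratios of consecutive binomial coefficients leaves the
-- two identities; every constant divided by is nonzero since p > 2d > N.

open import Data.Nat using (ℕ; NonZero; _<_)
open import Data.Nat.Primality using (Prime)
open import Data.List using (List; _∷_)
open import Data.List.Relation.Unary.All using (All)
open import Data.List.Relation.Unary.Unique.Propositional using (Unique)
open import Relation.Binary.PropositionalEquality using (_≡_; _≢_)

module Rings where

  open import Level using (0ℓ)
  open import Algebra.Bundles using (CommutativeRing)
  open import Algebra.Structures using (IsCommutativeRing)
  open import Data.Nat as ℕ using (ℕ; zero; suc)
  open import Data.Nat.Properties using (+-suc)
  open import Data.Integer as ℤ using (ℤ; -[1+_]; _⊖_; _◃_; sign; ∣_∣)
  import Data.Integer.Properties as ℤ
  open import Data.Sign as Sign using (Sign)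
  open import Data.Maybe using (Maybe; just; nothing)
  open import Relation.Nullary using (yes; no)
  open import Relation.Binary.PropositionalEquality
  open import Relation.Binary.Definitions using (DecidableEquality)
  import Algebra.Solver.Ring.AlmostCommutativeRing as ACR

  record CommRing : Set₁ where
    infixl 6 _+_ _-_
    infixl 7 _*_
    infix 8 -_
    field
      Carrier : Set
      _+_ _*_ : Carrier → Carrier → Carrier
      -_ : Carrier → Carrier
      0# 1# : Carrier
      isCommutativeRing : IsCommutativeRing _≡_ _+_ _*_ -_ 0# 1#

    _-_ : Carrier → Carrier → Carrier
    x - y = x + - y

    commutativeRing : CommutativeRing 0ℓ 0ℓ
    commutativeRing = record { isCommutativeRing = isCommutativeRing }

    open CommutativeRing commutativeRing public
      using ( +-assoc; +-comm; +-identityˡ; +-identityʳ; -‿inverseʳ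
            ; *-assoc; *-comm; *-identityˡ; *-identityʳ; zeroˡ; zeroʳ
            ; ring; semiring; +-abelianGroup)

  record DecField : Set₁ where
    infix 4 _≟_
    field
      commRing : CommRing
    open CommRing commRing public
    field
      _≟_ : DecidableEquality Carrier
      inv : Carrier → Carrier
      inverseʳ : ∀ {x} → x ≢ 0# → x * inv x ≡ 1#
      1≢0 : 1# ≢ 0#

  -- Integer coefficients, rather than the ring's own, let the normaliser see cancellations such as x - x = 0.
  module Solver (R : CommRing) where
    open CommRing R
    open import Algebra.Properties.Semiring.Mult.TCOptimised semiring using (_×_; 1+×; ×-homo-+; ×1-homo-*)
    open import Algebra.Properties.Ring ring using (-‿involutive; -0#≈0#; -1*x≈-x)
    open import Algebra.Properties.AbelianGroup +-abelianGroup using (⁻¹-∙-comm)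
    open import Algebra.Properties.CommutativeSemigroup
      (CommutativeRing.+-commutativeSemigroup commutativeRing) using (interchange)

    fromℕ : ℕ → Carrier
    fromℕ n = n × 1#

    fromℕ-suc : ∀ n → fromℕ (suc n) ≡ 1# + fromℕ n
    fromℕ-suc n = 1+× n 1#

    fromℕ-+ : ∀ m n → fromℕ (m ℕ.+ n) ≡ fromℕ m + fromℕ n
    fromℕ-+ = ×-homo-+ 1#

    fromℕ-* : ∀ m n → fromℕ (m ℕ.* n) ≡ fromℕ m * fromℕ n
    fromℕ-* = ×1-homo-*

    private
      fromℤ : ℤ → Carrier
      fromℤ (ℤ.+ n) = fromℕ n
      fromℤ -[1+ n ] = - fromℕ (suc n)

      sign→ : Sign → Carrier
      sign→ Sign.+ = 1#
      sign→ Sign.- = - 1#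

      sign→-* : ∀ s t → sign→ (s Sign.* t) ≡ sign→ s * sign→ t
      sign→-* Sign.+ t = sym (*-identityˡ _)
      sign→-* Sign.- Sign.+ = sym (*-identityʳ _)
      sign→-* Sign.- Sign.- = sym (trans (-1*x≈-x (- 1#)) (-‿involutive 1#))

      fromℤ-◃ : ∀ s n → fromℤ (s ◃ n) ≡ sign→ s * fromℕ n
      fromℤ-◃ s zero = sym (zeroʳ _)
      fromℤ-◃ Sign.+ (suc n) = sym (*-identityˡ _)
      fromℤ-◃ Sign.- (suc n) = sym (-1*x≈-x _)

      fromℤ-sign-abs : ∀ i → fromℤ i ≡ sign→ (sign i) * fromℕ ∣ i ∣
      fromℤ-sign-abs i = trans (cong fromℤ (sym (ℤ.◃-inverse i))) (fromℤ-◃ (sign i) ∣ i ∣)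

      suc-sub-suc : ∀ m n → (1# + m) - (1# + n) ≡ m - n
      suc-sub-suc m n = begin
        (1# + m) + - (1# + n)   ≡⟨ cong ((1# + m) +_) (⁻¹-∙-comm 1# n) ⟨
        (1# + m) + (- 1# + - n) ≡⟨ interchange 1# m (- 1#) (- n) ⟩
        (1# - 1#) + (m - n)     ≡⟨ cong (_+ (m - n)) (-‿inverseʳ 1#) ⟩
        0# + (m - n)            ≡⟨ +-identityˡ _ ⟩
        m - n                   ∎
        where open ≡-Reasoning

      fromℤ-⊖ : ∀ m n → fromℤ (m ⊖ n) ≡ fromℕ m - fromℕ n
      fromℤ-⊖ zero zero = sym (trans (cong (0# +_) -0#≈0#) (+-identityʳ 0#))
      fromℤ-⊖ (suc m) zero = sym (trans (cong (fromℕ (suc m) +_) -0#≈0#) (+-identityʳ _))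
      fromℤ-⊖ zero (suc n) = sym (+-identityˡ _)
      fromℤ-⊖ (suc m) (suc n) = begin
        fromℤ (suc m ⊖ suc n)            ≡⟨ cong fromℤ (ℤ.[1+m]⊖[1+n]≡m⊖n m n) ⟩
        fromℤ (m ⊖ n)                    ≡⟨ fromℤ-⊖ m n ⟩
        fromℕ m - fromℕ n                ≡⟨ suc-sub-suc (fromℕ m) (fromℕ n) ⟨
        (1# + fromℕ m) - (1# + fromℕ n)  ≡⟨ cong₂ _-_ (fromℕ-suc m) (fromℕ-suc n) ⟨
        fromℕ (suc m) - fromℕ (suc n)    ∎
        where open ≡-Reasoning

      fromℤ-+ : ∀ i j → fromℤ (i ℤ.+ j) ≡ fromℤ i + fromℤ j
      fromℤ-+ (ℤ.+ m) (ℤ.+ n) = fromℕ-+ m n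
      fromℤ-+ (ℤ.+ m) -[1+ n ] = fromℤ-⊖ m (suc n)
      fromℤ-+ -[1+ m ] (ℤ.+ n) = trans (fromℤ-⊖ n (suc m)) (+-comm _ _)
      fromℤ-+ -[1+ m ] -[1+ n ] = begin
        - fromℕ (suc (suc (m ℕ.+ n)))       ≡⟨ cong (λ k → - fromℕ (suc k)) (+-suc m n) ⟨
        - fromℕ (suc m ℕ.+ suc n)           ≡⟨ cong -_ (fromℕ-+ (suc m) (suc n)) ⟩
        - (fromℕ (suc m) + fromℕ (suc n))   ≡⟨ ⁻¹-∙-comm _ _ ⟨
        - fromℕ (suc m) + - fromℕ (suc n)   ∎
        where open ≡-Reasoning

      fromℤ-* : ∀ i j → fromℤ (i ℤ.* j) ≡ fromℤ i * fromℤ j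
      fromℤ-* i j = begin
        fromℤ (i ℤ.* j)                                       ≡⟨ fromℤ-◃ (sign i Sign.* sign j) (∣ i ∣ ℕ.* ∣ j ∣) ⟩
        sign→ (sign i Sign.* sign j) * fromℕ (∣ i ∣ ℕ.* ∣ j ∣)  ≡⟨ cong₂ _*_ (sign→-* (sign i) (sign j)) (fromℕ-* ∣ i ∣ ∣ j ∣) ⟩
        (s * t) * (m * n)                                     ≡⟨ interchange* s t m n ⟩
        (s * m) * (t * n)                                     ≡⟨ cong₂ _*_ (fromℤ-sign-abs i) (fromℤ-sign-abs j) ⟨
        fromℤ i * fromℤ j                                     ∎
        where
        open ≡-Reasoning
        open import Algebra.Properties.CommutativeSemigroup
          (CommutativeRing.*-commutativeSemigroup commutativeRing) renaming (interchange to interchange*)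
        s = sign→ (sign i)
        t = sign→ (sign j)
        m = fromℕ ∣ i ∣
        n = fromℕ ∣ j ∣

      fromℤ-neg : ∀ i → fromℤ (ℤ.- i) ≡ - fromℤ i
      fromℤ-neg (ℤ.+ zero) = sym -0#≈0#
      fromℤ-neg (ℤ.+ suc n) = refl
      fromℤ-neg -[1+ n ] = sym (-‿involutive _)

      homomorphism : ℤ.+-*-rawRing ACR.-Raw-AlmostCommutative⟶ ACR.fromCommutativeRing commutativeRing
      homomorphism = record
        { ⟦_⟧ = fromℤ ; +-homo = fromℤ-+ ; *-homo = fromℤ-* ; -‿homo = fromℤ-neg
        ; 0-homo = refl ; 1-homo = refl }

      fromℤ-≟ : ∀ i j → Maybe (fromℤ i ≡ fromℤ j)
      fromℤ-≟ i j with i ℤ.≟ j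
      ... | yes refl = just refl
      ... | no _ = nothing

    open import Algebra.Solver.Ring ℤ.+-*-rawRing (ACR.fromCommutativeRing commutativeRing) homomorphism fromℤ-≟ public

    :0 :1 : ∀ {n} → Polynomial n
    :0 = con (ℤ.+ 0)
    :1 = con (ℤ.+ 1)

open Rings using (CommRing; DecField; module Solver)

module Binomial where

  open import Data.Nat using (zero; suc; _+_; _*_; _∸_; _<_; _≤_; s≤s; z≤n)
  open import Data.Nat.Properties
  open import Data.Nat.Combinatorics using (_C_; nC1≡n; k>n⇒nCk≡0; nCk+nC[k+1]≡[n+1]C[k+1])
  open import Data.Nat.Divisibility using (_∣_; divides; ∣⇒≤)
  open import Data.Nat.Primality using (Prime; euclidsLemma)
  open import Data.Nat.Tactic.RingSolver using (solve-∀)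
  open import Data.Sum using (inj₁; inj₂)
  open import Data.Empty using (⊥-elim)
  open import Relation.Binary.PropositionalEquality

  [k+1]*[n+1]C[k+1]≡[n+1]*nCk : ∀ n k → suc k * (suc n C suc k) ≡ suc n * (n C k)
  [k+1]*[n+1]C[k+1]≡[n+1]*nCk zero zero = refl
  [k+1]*[n+1]C[k+1]≡[n+1]*nCk zero (suc k) =
    trans (cong (suc (suc k) *_) 1C[k+2]≡0) (trans (*-zeroʳ (suc (suc k))) (sym (cong (1 *_) 0C[k+1]≡0)))
    where
    1C[k+2]≡0 : 1 C suc (suc k) ≡ 0
    1C[k+2]≡0 = k>n⇒nCk≡0 {n = 1} {k = suc (suc k)} (s≤s (s≤s z≤n))
    0C[k+1]≡0 : 0 C suc k ≡ 0
    0C[k+1]≡0 = k>n⇒nCk≡0 {n = 0} {k = suc k} (s≤s z≤n)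
  [k+1]*[n+1]C[k+1]≡[n+1]*nCk (suc n) zero = trans (*-identityˡ _) (trans (nC1≡n (suc (suc n))) (sym (*-identityʳ (suc (suc n)))))
  [k+1]*[n+1]C[k+1]≡[n+1]*nCk (suc n) (suc k) = begin
    suc (suc k) * (suc (suc n) C suc (suc k))
      ≡⟨ cong (suc (suc k) *_) (nCk+nC[k+1]≡[n+1]C[k+1] (suc n) (suc k)) ⟨
    suc (suc k) * (x + y)
      ≡⟨ expand k x y ⟩
    x + suc k * x + suc (suc k) * y
      ≡⟨ cong₂ (λ u v → x + u + v) ([k+1]*[n+1]C[k+1]≡[n+1]*nCk n k) ([k+1]*[n+1]C[k+1]≡[n+1]*nCk n (suc k)) ⟩
    x + suc n * (n C k) + suc n * (n C suc k)
      ≡⟨ collect n x (n C k) (n C suc k) ⟩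
    x + suc n * (n C k + n C suc k)
      ≡⟨ cong (λ u → x + suc n * u) (nCk+nC[k+1]≡[n+1]C[k+1] n k) ⟩
    suc (suc n) * x ∎
    where
    open ≡-Reasoning
    x = suc n C suc k
    y = suc n C suc (suc k)
    expand : ∀ k x y → suc (suc k) * (x + y) ≡ x + suc k * x + suc (suc k) * y
    expand = solve-∀
    collect : ∀ n x u v → x + suc n * u + suc n * v ≡ x + suc n * (u + v)
    collect = solve-∀

  [n+1∸k]*[n+1]Ck≡[n+1]*nCk : ∀ n k → k ≤ suc n → (suc n ∸ k) * (suc n C k) ≡ suc n * (n C k)
  [n+1∸k]*[n+1]Ck≡[n+1]*nCk n zero _ = refl
  [n+1∸k]*[n+1]Ck≡[n+1]*nCk n (suc k) (s≤s k≤n) = +-cancelˡ-≡ (suc k * x) _ _ (begin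
    suc k * x + (n ∸ k) * x             ≡⟨ *-distribʳ-+ x (suc k) (n ∸ k) ⟨
    (suc k + (n ∸ k)) * x               ≡⟨ cong (_* x) (m+[n∸m]≡n (s≤s k≤n)) ⟩
    suc n * x                           ≡⟨ cong (suc n *_) (nCk+nC[k+1]≡[n+1]C[k+1] n k) ⟨
    suc n * (n C k + n C suc k)         ≡⟨ *-distribˡ-+ (suc n) (n C k) (n C suc k) ⟩
    suc n * (n C k) + suc n * (n C suc k) ≡⟨ cong (_+ suc n * (n C suc k)) ([k+1]*[n+1]C[k+1]≡[n+1]*nCk n k) ⟨
    suc k * x + suc n * (n C suc k)     ∎)
    where
    open ≡-Reasoning
    x = suc n C suc k

  [k+1]*nC[k+1]≡[n∸k]*nCk : ∀ n k → k < n → suc k * (n C suc k) ≡ (n ∸ k) * (n C k)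
  [k+1]*nC[k+1]≡[n∸k]*nCk (suc n) k (s≤s k≤n) =
    trans ([k+1]*[n+1]C[k+1]≡[n+1]*nCk n k) (sym ([n+1∸k]*[n+1]Ck≡[n+1]*nCk n k (m≤n⇒m≤1+n k≤n)))

  p∣pCk : ∀ {p k} → Prime p → 0 < k → k < p → p ∣ p C k
  p∣pCk {suc p} {suc k} p-prime _ k<p with euclidsLemma (suc k) (suc p C suc k) p-prime (divides (p C k) absorption)
    where
    absorption : suc k * (suc p C suc k) ≡ (p C k) * suc p
    absorption = trans ([k+1]*[n+1]C[k+1]≡[n+1]*nCk p k) (*-comm (suc p) (p C k))
  ... | inj₁ p∣k+1 = ⊥-elim (<⇒≱ k<p (∣⇒≤ p∣k+1))
  ... | inj₂ p∣pCk = p∣pCk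

module Polynomials (R : CommRing) where

  import Algebra.Bundles
  open import Data.Nat as ℕ using (ℕ; zero; suc; _≤_; _<_; z≤n; s≤s)
  import Data.Nat.Properties as ℕ
  open import Data.Nat.Combinatorics using (_C_; k>n⇒nCk≡0; nCn≡1; nCk+nC[k+1]≡[n+1]C[k+1])
  open Binomial using ([k+1]*[n+1]C[k+1]≡[n+1]*nCk; [k+1]*nC[k+1]≡[n∸k]*nCk)
  open import Data.List using (List; []; _∷_; _++_; length; replicate; foldr)
  open import Data.List.Membership.Propositional using (_∈_)
  open import Data.List.Relation.Unary.Any using (here; there)
  open import Data.Product using (_×_; _,_)
  open import Data.Unit using (⊤)
  open import Data.Empty using (⊥-elim)
  open import Function using (_∘_)
  open import Relation.Binary.PropositionalEquality
  open import Relation.Nullary using (yes; no)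

  open CommRing R
  open Rings.Solver R
  open import Algebra.Properties.Semiring.Exp semiring public using (_^_; ^-homo-*)
  open import Algebra.Properties.CommutativeSemiring.Exp
    (Algebra.Bundles.CommutativeRing.commutativeSemiring commutativeRing) public using (^-distrib-*)

  1^n≡1 : ∀ n → 1# ^ n ≡ 1#
  1^n≡1 zero = refl
  1^n≡1 (suc n) = trans (*-identityˡ _) (1^n≡1 n)

  Poly : Set
  Poly = List Carrier

  eval : Carrier → Poly → Carrier
  eval x [] = 0#
  eval x (a ∷ P) = a + x * eval x P

  coeff : Poly → ℕ → Carrier
  coeff [] _ = 0#
  coeff (a ∷ P) zero = a
  coeff (a ∷ P) (suc k) = coeff P k

  -- Horner's scheme: P = (x - c) · quot c P + eval c P.
  quot : Carrier → Poly → Poly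
  quot c [] = []
  quot c (a ∷ P) = eval c P ∷ quot c P

  infix 4 _≈_
  record _≈_ (P Q : Poly) : Set where
    constructor mk≈
    field at : ∀ k → coeff P k ≡ coeff Q k
  open _≈_ public

  ≈-refl : ∀ {P} → P ≈ P
  ≈-refl = mk≈ λ _ → refl

  ≈-sym : ∀ {P Q} → P ≈ Q → Q ≈ P
  ≈-sym e = mk≈ λ k → sym (at e k)

  ≈-trans : ∀ {P Q S} → P ≈ Q → Q ≈ S → P ≈ S
  ≈-trans e f = mk≈ λ k → trans (at e k) (at f k)

  ≈-tail : ∀ {a b P Q} → a ∷ P ≈ b ∷ Q → P ≈ Q
  ≈-tail e = mk≈ λ k → at e (suc k)

  ≈-tailˡ : ∀ {a P} → a ∷ P ≈ [] → P ≈ []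
  ≈-tailˡ e = mk≈ λ k → at e (suc k)

  Deg< : ℕ → Poly → Set
  Deg< n P = ∀ k → n ≤ k → coeff P k ≡ 0#

  Deg<-mono : ∀ {m n} P → m ≤ n → Deg< m P → Deg< n P
  Deg<-mono P m≤n deg k n≤k = deg k (ℕ.≤-trans m≤n n≤k)

  Deg<-tail : ∀ {n a} P → Deg< (suc n) (a ∷ P) → Deg< n P
  Deg<-tail P deg k n≤k = deg (suc k) (s≤s n≤k)

  Monic : ℕ → Poly → Set
  Monic n P = Deg< (suc n) P × coeff P n ≡ 1#

  infixl 6 _⊞_
  _⊞_ : Poly → Poly → Poly
  [] ⊞ Q = Q
  (a ∷ P) ⊞ [] = a ∷ P
  (a ∷ P) ⊞ (b ∷ Q) = a + b ∷ P ⊞ Q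

  scale : Carrier → Poly → Poly
  scale s [] = []
  scale s (a ∷ P) = s * a ∷ scale s P

  mulLin : Carrier → Poly → Poly
  mulLin c P = (0# ∷ P) ⊞ scale (- c) P

  prodLinOn : List Carrier → Poly → Poly
  prodLinOn L h = foldr mulLin h L

  prodLin : List Carrier → Poly
  prodLin L = prodLinOn L (1# ∷ [])

  private
    0+x*0≡0 : ∀ x → 0# + x * 0# ≡ 0#
    0+x*0≡0 = solve 1 (λ x → :0 :+ x :* :0 := :0) refl

    x+y*0≡x : ∀ x y → x + y * 0# ≡ x
    x+y*0≡x = solve 2 (λ x y → x :+ y :* :0 := x) refl

  coeff-⊞ : ∀ P Q k → coeff (P ⊞ Q) k ≡ coeff P k + coeff Q k
  coeff-⊞ [] Q k = sym (+-identityˡ _)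
  coeff-⊞ (a ∷ P) [] k = sym (+-identityʳ _)
  coeff-⊞ (a ∷ P) (b ∷ Q) zero = refl
  coeff-⊞ (a ∷ P) (b ∷ Q) (suc k) = coeff-⊞ P Q k

  coeff-scale : ∀ s P k → coeff (scale s P) k ≡ s * coeff P k
  coeff-scale s [] k = sym (zeroʳ s)
  coeff-scale s (a ∷ P) zero = refl
  coeff-scale s (a ∷ P) (suc k) = coeff-scale s P k

  coeff-mulLin-suc : ∀ c P k → coeff (mulLin c P) (suc k) ≡ coeff P k + (- c) * coeff P (suc k)
  coeff-mulLin-suc c P k = trans (coeff-⊞ (0# ∷ P) (scale (- c) P) (suc k)) (cong (coeff P k +_) (coeff-scale (- c) P (suc k)))

  coeff-mulLin-zero : ∀ c P → coeff (mulLin c P) 0 ≡ 0# + (- c) * coeff P 0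
  coeff-mulLin-zero c P = trans (coeff-⊞ (0# ∷ P) (scale (- c) P) 0) (cong (0# +_) (coeff-scale (- c) P 0))

  ⊞-cong : ∀ {P P′ Q Q′} → P ≈ P′ → Q ≈ Q′ → P ⊞ Q ≈ P′ ⊞ Q′
  ⊞-cong {P} {P′} {Q} {Q′} e f =
    mk≈ λ k → trans (coeff-⊞ P Q k) (trans (cong₂ _+_ (at e k) (at f k)) (sym (coeff-⊞ P′ Q′ k)))

  scale-cong : ∀ s {P Q} → P ≈ Q → scale s P ≈ scale s Q
  scale-cong s {P} {Q} e =
    mk≈ λ k → trans (coeff-scale s P k) (trans (cong (s *_) (at e k)) (sym (coeff-scale s Q k)))

  mulLin-cong : ∀ c {P Q} → P ≈ Q → mulLin c P ≈ mulLin c Q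
  mulLin-cong c e = ⊞-cong (mk≈ λ { zero → refl ; (suc k) → at e k }) (scale-cong (- c) e)

  eval-≈[] : ∀ x P → P ≈ [] → eval x P ≡ 0#
  eval-≈[] x [] e = refl
  eval-≈[] x (a ∷ P) e = trans (cong₂ (λ u v → u + x * v) (at e 0) (eval-≈[] x P (≈-tailˡ e))) (0+x*0≡0 x)

  eval-cong : ∀ x {P Q} → P ≈ Q → eval x P ≡ eval x Q
  eval-cong x {[]} {Q} e = sym (eval-≈[] x Q (≈-sym e))
  eval-cong x {a ∷ P} {[]} e = eval-≈[] x (a ∷ P) e
  eval-cong x {a ∷ P} {b ∷ Q} e = cong₂ (λ u v → u + x * v) (at e 0) (eval-cong x (≈-tail e))

  eval-Deg<1 : ∀ x P → Deg< 1 P → eval x P ≡ coeff P 0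
  eval-Deg<1 x [] _ = refl
  eval-Deg<1 x (a ∷ P) deg = trans (cong (λ v → a + x * v) (eval-≈[] x P (mk≈ λ k → deg (suc k) (s≤s z≤n)))) (x+y*0≡x a x)

  quot-≈[] : ∀ c P → P ≈ [] → quot c P ≈ []
  quot-≈[] c [] e = ≈-refl
  quot-≈[] c (a ∷ P) e = mk≈ λ { zero → eval-≈[] c P (≈-tailˡ e) ; (suc k) → at (quot-≈[] c P (≈-tailˡ e)) k }

  quot-cong : ∀ c {P Q} → P ≈ Q → quot c P ≈ quot c Q
  quot-cong c {[]} {Q} e = ≈-sym (quot-≈[] c Q (≈-sym e))
  quot-cong c {a ∷ P} {[]} e = quot-≈[] c (a ∷ P) e
  quot-cong c {a ∷ P} {b ∷ Q} e = mk≈ λ { zero → eval-cong c (≈-tail e) ; (suc k) → at (quot-cong c (≈-tail e)) k }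

  eval-⊞ : ∀ x P Q → eval x (P ⊞ Q) ≡ eval x P + eval x Q
  eval-⊞ x [] Q = sym (+-identityˡ _)
  eval-⊞ x (a ∷ P) [] = sym (+-identityʳ _)
  eval-⊞ x (a ∷ P) (b ∷ Q) = trans (cong (λ v → (a + b) + x * v) (eval-⊞ x P Q))
    (solve 5 (λ a b x u v → (a :+ b) :+ x :* (u :+ v) := (a :+ x :* u) :+ (b :+ x :* v)) refl a b x (eval x P) (eval x Q))

  eval-scale : ∀ x s P → eval x (scale s P) ≡ s * eval x P
  eval-scale x s [] = sym (zeroʳ s)
  eval-scale x s (a ∷ P) = trans (cong (λ v → s * a + x * v) (eval-scale x s P))
    (solve 4 (λ s a x u → s :* a :+ x :* (s :* u) := s :* (a :+ x :* u)) refl s a x (eval x P))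

  eval-mulLin : ∀ x c P → eval x (mulLin c P) ≡ (x - c) * eval x P
  eval-mulLin x c P = trans (eval-⊞ x (0# ∷ P) (scale (- c) P))
    (trans (cong ((0# + x * eval x P) +_) (eval-scale x (- c) P))
      (solve 3 (λ x c u → (:0 :+ x :* u) :+ (:- c) :* u := (x :- c) :* u) refl x c (eval x P)))

  eval-prodLinOn : ∀ x L h → eval x (prodLinOn L h) ≡ eval x (prodLin L) * eval x h
  eval-prodLinOn x [] h = sym (trans (cong (_* eval x h) (x+y*0≡x 1# x)) (*-identityˡ _))
  eval-prodLinOn x (c ∷ L) h = begin
    eval x (mulLin c (prodLinOn L h))              ≡⟨ eval-mulLin x c (prodLinOn L h) ⟩
    (x - c) * eval x (prodLinOn L h)               ≡⟨ cong ((x - c) *_) (eval-prodLinOn x L h) ⟩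
    (x - c) * (eval x (prodLin L) * eval x h)      ≡⟨ *-assoc _ _ _ ⟨
    ((x - c) * eval x (prodLin L)) * eval x h      ≡⟨ cong (_* eval x h) (eval-mulLin x c (prodLin L)) ⟨
    eval x (prodLin (c ∷ L)) * eval x h            ∎
    where open ≡-Reasoning

  eval-prodLin-root : ∀ x L → x ∈ L → eval x (prodLin L) ≡ 0#
  eval-prodLin-root x (c ∷ L) (here refl) =
    trans (eval-mulLin x x (prodLin L)) (trans (cong (_* eval x (prodLin L)) (-‿inverseʳ x)) (zeroˡ _))
  eval-prodLin-root x (c ∷ L) (there x∈L) =
    trans (eval-mulLin x c (prodLin L)) (trans (cong ((x - c) *_) (eval-prodLin-root x L x∈L)) (zeroʳ _))

  quot-⊞ : ∀ c P Q → quot c (P ⊞ Q) ≈ quot c P ⊞ quot c Q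
  quot-⊞ c [] Q = ≈-refl
  quot-⊞ c (a ∷ P) [] = ≈-refl
  quot-⊞ c (a ∷ P) (b ∷ Q) = mk≈ λ { zero → eval-⊞ c P Q ; (suc k) → at (quot-⊞ c P Q) k }

  quot-scale : ∀ c s P → quot c (scale s P) ≈ scale s (quot c P)
  quot-scale c s [] = ≈-refl
  quot-scale c s (a ∷ P) = mk≈ λ { zero → eval-scale c s P ; (suc k) → at (quot-scale c s P) k }

  coeff-quot-∷ : ∀ c a P k → coeff (quot c (a ∷ P)) k ≡ coeff P k + c * coeff (quot c P) k
  coeff-quot-∷ c a [] zero = sym (0+x*0≡0 c)
  coeff-quot-∷ c a [] (suc k) = sym (0+x*0≡0 c)
  coeff-quot-∷ c a (a′ ∷ P) zero = refl
  coeff-quot-∷ c a (a′ ∷ P) (suc k) = coeff-quot-∷ c a′ P k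

  quot-mulLin : ∀ b c P → quot b (mulLin c P) ≈ P ⊞ scale (b - c) (quot b P)
  quot-mulLin b c P = mk≈ coeffwise
    where
    open ≡-Reasoning
    coeffwise : ∀ k → coeff (quot b (mulLin c P)) k ≡ coeff (P ⊞ scale (b - c) (quot b P)) k
    coeffwise k = let q = coeff (quot b P) k in begin
      coeff (quot b (mulLin c P)) k
        ≡⟨ at (quot-⊞ b (0# ∷ P) (scale (- c) P)) k ⟩
      coeff (quot b (0# ∷ P) ⊞ quot b (scale (- c) P)) k
        ≡⟨ coeff-⊞ (quot b (0# ∷ P)) (quot b (scale (- c) P)) k ⟩
      coeff (quot b (0# ∷ P)) k + coeff (quot b (scale (- c) P)) k
        ≡⟨ cong₂ _+_ (coeff-quot-∷ b 0# P k) (trans (at (quot-scale b (- c) P) k) (coeff-scale (- c) (quot b P) k)) ⟩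
      (coeff P k + b * q) + (- c) * q
        ≡⟨ solve 4 (λ u b c q → (u :+ b :* q) :+ (:- c) :* q := u :+ (b :- c) :* q) refl (coeff P k) b c q ⟩
      coeff P k + (b - c) * q
        ≡⟨ cong (coeff P k +_) (coeff-scale (b - c) (quot b P) k) ⟨
      coeff P k + coeff (scale (b - c) (quot b P)) k
        ≡⟨ coeff-⊞ P (scale (b - c) (quot b P)) k ⟨
      coeff (P ⊞ scale (b - c) (quot b P)) k ∎

  coeff-quot-suc : ∀ c P k → coeff P (suc k) ≡ coeff (quot c P) k + (- c) * coeff (quot c P) (suc k)
  coeff-quot-suc c [] k = sym (0+x*0≡0 (- c))
  coeff-quot-suc c (a ∷ P) k =
    trans (solve 3 (λ u c q → u := (u :+ c :* q) :+ (:- c) :* q) refl (coeff P k) c (coeff (quot c P) k))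
          (cong (_+ (- c) * coeff (quot c P) k) (sym (coeff-quot-∷ c a P k)))

  division : ∀ c P → P ≈ mulLin c (quot c P) ⊞ (eval c P ∷ [])
  division c P = mk≈ λ
    { zero → trans (coeff-zero P) (sym (trans (coeff-⊞ (mulLin c (quot c P)) _ 0)
                                            (cong (_+ eval c P) (coeff-mulLin-zero c (quot c P)))))
    ; (suc k) → trans (coeff-quot-suc c P k) (sym (trans (coeff-⊞ (mulLin c (quot c P)) (eval c P ∷ []) (suc k))
                                                        (trans (+-identityʳ _) (coeff-mulLin-suc c (quot c P) k)))) }
    where
    coeff-zero : ∀ P → coeff P 0 ≡ (0# + (- c) * coeff (quot c P) 0) + eval c P
    coeff-zero [] = solve 1 (λ c → :0 := (:0 :+ (:- c) :* :0) :+ :0) refl c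
    coeff-zero (a ∷ P) = solve 3 (λ a c u → a := (:0 :+ (:- c) :* u) :+ (a :+ c :* u)) refl a c (eval c P)

  eval-division : ∀ x c P → eval x P ≡ (x - c) * eval x (quot c P) + eval c P
  eval-division x c P = trans (eval-cong x (division c P)) (trans (eval-⊞ x (mulLin c (quot c P)) (eval c P ∷ []))
    (cong₂ _+_ (eval-mulLin x c (quot c P)) (x+y*0≡x (eval c P) x)))

  Deg<-quot : ∀ c n P → Deg< (suc n) P → Deg< n (quot c P)
  Deg<-quot c n [] deg k _ = refl
  Deg<-quot c n (a ∷ P) deg k n≤k = trans (coeff-quot-∷ c a P k)
    (trans (cong₂ (λ u v → u + c * v) (Deg<-tail P deg k n≤k)
                                     (Deg<-quot c n P (Deg<-mono P (ℕ.n≤1+n n) (Deg<-tail P deg)) k n≤k))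
           (0+x*0≡0 c))

  coeff-quot-top : ∀ c n P → Deg< (suc (suc n)) P → coeff (quot c P) n ≡ coeff P (suc n)
  coeff-quot-top c n P deg = sym (trans (coeff-quot-suc c P n)
    (trans (cong (λ v → coeff (quot c P) n + (- c) * v) (Deg<-quot c (suc n) P deg (suc n) ℕ.≤-refl))
           (x+y*0≡x _ (- c))))

  mulLin-monic : ∀ c n P → Monic n P → Monic (suc n) (mulLin c P)
  mulLin-monic c n P (deg , top) = deg′ , trans (coeff-mulLin-suc c P n)
    (trans (cong₂ (λ u v → u + (- c) * v) top (deg (suc n) ℕ.≤-refl)) (x+y*0≡x 1# (- c)))
    where
    deg′ : Deg< (suc (suc n)) (mulLin c P)
    deg′ (suc k) (s≤s n<k) = trans (coeff-mulLin-suc c P k)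
      (trans (cong₂ (λ u v → u + (- c) * v) (deg k n<k) (deg (suc k) (ℕ.m≤n⇒m≤1+n n<k))) (0+x*0≡0 (- c)))

  prodLinOn-monic : ∀ L n h → Monic n h → Monic (length L ℕ.+ n) (prodLinOn L h)
  prodLinOn-monic [] n h mon = mon
  prodLinOn-monic (c ∷ L) n h mon = mulLin-monic c (length L ℕ.+ n) (prodLinOn L h) (prodLinOn-monic L n h mon)

  1-monic : Monic 0 (1# ∷ [])
  1-monic = (λ { (suc k) _ → refl }) , refl

  prodLin-monic : ∀ L → Monic (length L) (prodLin L)
  prodLin-monic L = subst (λ n → Monic n (prodLin L)) (ℕ.+-identityʳ (length L)) (prodLinOn-monic L 0 _ 1-monic)

  monomial : ℕ → Poly
  monomial zero = 1# ∷ []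
  monomial (suc n) = 0# ∷ monomial n

  eval-monomial : ∀ x n → eval x (monomial n) ≡ x ^ n
  eval-monomial x zero = x+y*0≡x 1# x
  eval-monomial x (suc n) = trans (+-identityˡ _) (cong (x *_) (eval-monomial x n))

  coeff-monomial-≢ : ∀ {n k} → k ≢ n → coeff (monomial n) k ≡ 0#
  coeff-monomial-≢ {zero} {zero} k≢n = ⊥-elim (k≢n refl)
  coeff-monomial-≢ {zero} {suc k} _ = refl
  coeff-monomial-≢ {suc n} {zero} _ = refl
  coeff-monomial-≢ {suc n} {suc k} k≢n = coeff-monomial-≢ (k≢n ∘ cong suc)

  coeff-monomial-≡ : ∀ n → coeff (monomial n) n ≡ 1#
  coeff-monomial-≡ zero = refl
  coeff-monomial-≡ (suc n) = coeff-monomial-≡ n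

  monomial-monic : ∀ n → Monic n (monomial n)
  monomial-monic n = (λ k n<k → coeff-monomial-≢ (ℕ.>⇒≢ n<k)) , coeff-monomial-≡ n

  shift : ℕ → Poly → Poly
  shift n P = replicate n 0# ++ P

  eval-shift : ∀ x n P → eval x (shift n P) ≡ x ^ n * eval x P
  eval-shift x zero P = sym (*-identityˡ _)
  eval-shift x (suc n) P = trans (+-identityˡ _) (trans (cong (x *_) (eval-shift x n P)) (sym (*-assoc _ _ _)))

  coeff-shift : ∀ n P {j} → n ≤ j → coeff (shift n P) j ≡ coeff P (j ℕ.∸ n)
  coeff-shift zero P _ = refl
  coeff-shift (suc n) P {suc j} (s≤s n≤j) = coeff-shift n P n≤j

  -- Roots with multiplicity: b₁ is a root of P, b₂ one of P / (x - b₁), and so on.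
  HasRoots : Poly → List Carrier → Set
  HasRoots P [] = ⊤
  HasRoots P (b ∷ L) = eval b P ≡ 0# × HasRoots (quot b P) L

  tooManyRoots⇒≈[] : ∀ L P n → Deg< n P → n ≤ length L → HasRoots P L → P ≈ []
  tooManyRoots⇒≈[] [] P zero deg _ _ = mk≈ λ k → deg k z≤n
  tooManyRoots⇒≈[] (b ∷ L) P n deg n≤1+L (root , roots) = ≈-trans (division b P) (mk≈ λ k →
    trans (coeff-⊞ (mulLin b (quot b P)) _ k)
          (trans (cong₂ _+_ (trans (at (mulLin-cong b quot≈[]) k) (mulLin-[] k)) (remainder k)) (+-identityʳ 0#)))
    where
    quot≈[] : quot b P ≈ []
    quot≈[] = tooManyRoots⇒≈[] L (quot b P) (n ℕ.∸ 1)
      (Deg<-quot b (n ℕ.∸ 1) P (Deg<-mono P (ℕ.m≤n+m∸n n 1) deg)) (ℕ.∸-monoˡ-≤ 1 n≤1+L) roots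
    mulLin-[] : ∀ k → coeff (mulLin b []) k ≡ 0#
    mulLin-[] zero = refl
    mulLin-[] (suc k) = refl
    remainder : ∀ k → coeff (eval b P ∷ []) k ≡ 0#
    remainder zero = root
    remainder (suc k) = refl

  -- Taylor coefficients: P = Σⱼ taylor b P j · (x - b)ʲ.
  quot^ : Carrier → ℕ → Poly → Poly
  quot^ b zero P = P
  quot^ b (suc j) P = quot^ b j (quot b P)

  quot^-suc : ∀ b j P → quot^ b (suc j) P ≡ quot b (quot^ b j P)
  quot^-suc b zero P = refl
  quot^-suc b (suc j) P = quot^-suc b j (quot b P)

  taylor : Carrier → Poly → ℕ → Carrier
  taylor b P j = eval b (quot^ b j P)

  taylor-cong : ∀ b j {P Q} → P ≈ Q → taylor b P j ≡ taylor b Q j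
  taylor-cong b zero e = eval-cong b e
  taylor-cong b (suc j) e = taylor-cong b j (quot-cong b e)

  taylor-⊞ : ∀ b j P Q → taylor b (P ⊞ Q) j ≡ taylor b P j + taylor b Q j
  taylor-⊞ b zero P Q = eval-⊞ b P Q
  taylor-⊞ b (suc j) P Q = trans (taylor-cong b j (quot-⊞ b P Q)) (taylor-⊞ b j (quot b P) (quot b Q))

  taylor-scale : ∀ b j s P → taylor b (scale s P) j ≡ s * taylor b P j
  taylor-scale b zero s P = eval-scale b s P
  taylor-scale b (suc j) s P = trans (taylor-cong b j (quot-scale b s P)) (taylor-scale b j s (quot b P))

  taylor-≈[] : ∀ b j P → P ≈ [] → taylor b P j ≡ 0#
  taylor-≈[] b j P e = trans (taylor-cong b j e) (taylor-[] j)
    where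
    taylor-[] : ∀ j → taylor b [] j ≡ 0#
    taylor-[] zero = refl
    taylor-[] (suc j) = taylor-[] j

  taylor-const-zero : ∀ b a → taylor b (a ∷ []) 0 ≡ a
  taylor-const-zero b a = x+y*0≡x a b

  taylor-const-suc : ∀ b a j → taylor b (a ∷ []) (suc j) ≡ 0#
  taylor-const-suc b a j = trans (cong (eval b) (quot^-0 j)) (0+x*0≡0 b)
    where
    quot^-0 : ∀ j → quot^ b j (0# ∷ []) ≡ 0# ∷ []
    quot^-0 zero = refl
    quot^-0 (suc j) = quot^-0 j

  taylor-mulLin-zero : ∀ b c P → taylor b (mulLin c P) 0 ≡ (b - c) * taylor b P 0
  taylor-mulLin-zero b c P = eval-mulLin b c P

  taylor-mulLin-suc : ∀ b c P j → taylor b (mulLin c P) (suc j) ≡ taylor b P j + (b - c) * taylor b P (suc j)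
  taylor-mulLin-suc b c P j = trans (taylor-cong b j (quot-mulLin b c P))
    (trans (taylor-⊞ b j P _) (cong (taylor b P j +_) (taylor-scale b j (b - c) (quot b P))))

  taylor-mulLin-self : ∀ b P j → taylor b (mulLin b P) (suc j) ≡ taylor b P j
  taylor-mulLin-self b P j = trans (taylor-mulLin-suc b b P j)
    (solve 3 (λ b t u → t :+ (b :- b) :* u := t) refl b (taylor b P j) (taylor b P (suc j)))

  taylor-at-0 : ∀ k P → taylor 0# P k ≡ coeff P k
  taylor-at-0 zero [] = refl
  taylor-at-0 zero (a ∷ P) = trans (cong (a +_) (zeroˡ _)) (+-identityʳ a)
  taylor-at-0 (suc k) P = trans (taylor-at-0 k (quot 0# P)) (coeff-quot-at-0 P)
    where
    coeff-quot-at-0 : ∀ P → coeff (quot 0# P) k ≡ coeff P (suc k)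
    coeff-quot-at-0 [] = refl
    coeff-quot-at-0 (a ∷ P) = trans (coeff-quot-∷ 0# a P k) (trans (cong (coeff P k +_) (zeroˡ _)) (+-identityʳ _))

  binom : ℕ → ℕ → Carrier
  binom n k = fromℕ (n C k)

  binom-pascal : ∀ n k → binom (suc n) (suc k) ≡ binom n k + binom n (suc k)
  binom-pascal n k = trans (cong fromℕ (sym (nCk+nC[k+1]≡[n+1]C[k+1] n k))) (fromℕ-+ (n C k) (n C suc k))

  binom-> : ∀ {n k} → n < k → binom n k ≡ 0#
  binom-> n<k = cong fromℕ (k>n⇒nCk≡0 n<k)

  binom-diag : ∀ n → binom n n ≡ 1#
  binom-diag n = cong fromℕ (nCn≡1 n)

  binom-absorb : ∀ n k → fromℕ (suc k) * binom (suc n) (suc k) ≡ fromℕ (suc n) * binom n k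
  binom-absorb n k = trans (sym (fromℕ-* (suc k) (suc n C suc k)))
    (trans (cong fromℕ ([k+1]*[n+1]C[k+1]≡[n+1]*nCk n k)) (fromℕ-* (suc n) (n C k)))

  binom-ratio : ∀ {n k} → k < n → fromℕ (suc k) * binom n (suc k) ≡ fromℕ (n ℕ.∸ k) * binom n k
  binom-ratio {n} {k} k<n = trans (sym (fromℕ-* (suc k) (n C suc k)))
    (trans (cong fromℕ ([k+1]*nC[k+1]≡[n∸k]*nCk n k k<n)) (fromℕ-* (n ℕ.∸ k) (n C k)))

  binom-pascal-^ : ∀ e n j → binom n j * e ^ (n ℕ.∸ j) + e * (binom n (suc j) * e ^ (n ℕ.∸ suc j))
                            ≡ binom (suc n) (suc j) * e ^ (n ℕ.∸ j)
  binom-pascal-^ e n j with j ℕ.<? n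
  ... | yes j<n = begin
    binom n j * e ^ (n ℕ.∸ j) + e * (binom n (suc j) * q)   ≡⟨ cong (λ t → binom n j * t + e * (binom n (suc j) * q)) e^[n∸j] ⟩
    binom n j * (e * q) + e * (binom n (suc j) * q)         ≡⟨ solve 4 (λ u v e q → u :* (e :* q) :+ e :* (v :* q) := (u :+ v) :* (e :* q)) refl (binom n j) (binom n (suc j)) e q ⟩
    (binom n j + binom n (suc j)) * (e * q)                 ≡⟨ cong₂ _*_ (binom-pascal n j) e^[n∸j] ⟨
    binom (suc n) (suc j) * e ^ (n ℕ.∸ j)                   ∎
    where
    open ≡-Reasoning
    q = e ^ (n ℕ.∸ suc j)
    e^[n∸j] : e ^ (n ℕ.∸ j) ≡ e * q
    e^[n∸j] = cong (e ^_) (ℕ.+-∸-assoc 1 j<n)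
  ... | no j≮n = begin
    binom n j * e ^ (n ℕ.∸ j) + e * (binom n (suc j) * e ^ (n ℕ.∸ suc j))   ≡⟨ cong (λ v → binom n j * e ^ (n ℕ.∸ j) + e * (v * e ^ (n ℕ.∸ suc j))) nC[1+j]≡0 ⟩
    binom n j * e ^ (n ℕ.∸ j) + e * (0# * e ^ (n ℕ.∸ suc j))                ≡⟨ solve 4 (λ u e q r → u :* q :+ e :* (:0 :* r) := (u :+ :0) :* q) refl (binom n j) e (e ^ (n ℕ.∸ j)) (e ^ (n ℕ.∸ suc j)) ⟩
    (binom n j + 0#) * e ^ (n ℕ.∸ j)                                          ≡⟨ cong (λ v → (binom n j + v) * e ^ (n ℕ.∸ j)) nC[1+j]≡0 ⟨
    (binom n j + binom n (suc j)) * e ^ (n ℕ.∸ j)                             ≡⟨ cong (_* e ^ (n ℕ.∸ j)) (binom-pascal n j) ⟨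
    binom (suc n) (suc j) * e ^ (n ℕ.∸ j)                                     ∎
    where
    open ≡-Reasoning
    nC[1+j]≡0 : binom n (suc j) ≡ 0#
    nC[1+j]≡0 = binom-> (s≤s (ℕ.≮⇒≥ j≮n))

  powLin : ℕ → Carrier → Poly
  powLin n c = prodLin (replicate n c)

  powLin-monic : ∀ n c → Monic n (powLin n c)
  powLin-monic n c = subst (λ m → Monic m (powLin n c)) (length-replicate n) (prodLin-monic (replicate n c))
    where open import Data.List.Properties using (length-replicate)

  eval-powLin : ∀ x n c → eval x (powLin n c) ≡ (x - c) ^ n
  eval-powLin x zero c = x+y*0≡x 1# x
  eval-powLin x (suc n) c = trans (eval-mulLin x c (powLin n c)) (cong ((x - c) *_) (eval-powLin x n c))

  taylor-powLin : ∀ b n c j → taylor b (powLin n c) j ≡ binom n j * (b - c) ^ (n ℕ.∸ j)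
  taylor-powLin b zero c zero = trans (taylor-const-zero b 1#) (sym (*-identityˡ 1#))
  taylor-powLin b zero c (suc j) = trans (taylor-const-suc b 1# j) (sym (zeroˡ _))
  taylor-powLin b (suc n) c zero = begin
    taylor b (powLin (suc n) c) 0       ≡⟨ taylor-mulLin-zero b c (powLin n c) ⟩
    (b - c) * taylor b (powLin n c) 0   ≡⟨ cong ((b - c) *_) (taylor-powLin b n c 0) ⟩
    (b - c) * (1# * (b - c) ^ n)        ≡⟨ solve 2 (λ e q → e :* (:1 :* q) := :1 :* (e :* q)) refl (b - c) ((b - c) ^ n) ⟩
    1# * (b - c) ^ suc n                ∎
    where open ≡-Reasoning
  taylor-powLin b (suc n) c (suc j) = begin
    taylor b (powLin (suc n) c) (suc j)
      ≡⟨ taylor-mulLin-suc b c (powLin n c) j ⟩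
    taylor b (powLin n c) j + (b - c) * taylor b (powLin n c) (suc j)
      ≡⟨ cong₂ (λ u v → u + (b - c) * v) (taylor-powLin b n c j) (taylor-powLin b n c (suc j)) ⟩
    binom n j * (b - c) ^ (n ℕ.∸ j) + (b - c) * (binom n (suc j) * (b - c) ^ (n ℕ.∸ suc j))
      ≡⟨ binom-pascal-^ (b - c) n j ⟩
    binom (suc n) (suc j) * (b - c) ^ (n ℕ.∸ j) ∎
    where open ≡-Reasoning

module CharacteristicP (R : CommRing) {p : ℕ} (p-prime : Prime p)
                 (fromℕ-p : Solver.fromℕ R p ≡ CommRing.0# R) where
  open import Data.Nat as ℕ using (ℕ; zero; suc; _<_; z≤n; s≤s)
  open import Data.Nat.Primality using (Prime)
  open import Relation.Binary.PropositionalEquality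
  open import Data.Sum using (_⊎_; inj₁; inj₂)
  open import Data.Empty using (⊥-elim)

  import Data.Nat.Properties as ℕ
  open import Data.Nat.Divisibility using (divides)
  open import Data.List using ([]; _∷_)
  open import Relation.Binary.Definitions using (tri<; tri≈; tri>)
  open import Data.Nat.Combinatorics using (_C_)
  open import Data.Product using (∃-syntax; _,_)
  open Binomial using (p∣pCk)

  open CommRing R
  open Solver R
  open Polynomials R

  private
    1<p : 1 < p
    1<p = ℕ.nonTrivial⇒n>1 p {{prime⇒nonTrivial p-prime}}
      where open import Data.Nat.Primality using (prime⇒nonTrivial)

  binom-p : ∀ {k} → 0 < k → k < p → binom p k ≡ 0#
  binom-p {k} 0<k k<p with p∣pCk p-prime 0<k k<p
  ... | divides q pCk≡q*p = begin
    fromℕ (p C k)            ≡⟨ cong fromℕ pCk≡q*p ⟩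
    fromℕ (q ℕ.* p)          ≡⟨ fromℕ-* q p ⟩
    fromℕ q * fromℕ p        ≡⟨ cong (fromℕ q *_) fromℕ-p ⟩
    fromℕ q * 0#             ≡⟨ zeroʳ _ ⟩
    0#                       ∎
    where open ≡-Reasoning

  powLin-p : ∀ c → powLin p c ≈ ((0# - c) ^ p ∷ []) ⊞ monomial p
  powLin-p c = mk≈ λ k → trans (coeff-powLin k) (sym (trans (coeff-⊞ ((0# - c) ^ p ∷ []) (monomial p) k) (coeff-rhs k)))
    where
    e = 0# - c
    coeff-powLin : ∀ k → coeff (powLin p c) k ≡ binom p k * e ^ (p ℕ.∸ k)
    coeff-powLin k = trans (sym (taylor-at-0 k (powLin p c))) (taylor-powLin 0# p c k)
    coeff-rhs : ∀ k → coeff (e ^ p ∷ []) k + coeff (monomial p) k ≡ binom p k * e ^ (p ℕ.∸ k)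
    coeff-rhs zero = trans (cong (e ^ p +_) (coeff-monomial-≢ (ℕ.<⇒≢ (ℕ.<-trans (s≤s z≤n) 1<p))))
                           (trans (+-identityʳ _) (sym (*-identityˡ _)))
    coeff-rhs (suc k) with ℕ.<-cmp (suc k) p
    ... | tri< k<p k≢p _ = trans (+-identityˡ _) (trans (coeff-monomial-≢ k≢p)
                             (sym (trans (cong (_* e ^ (p ℕ.∸ suc k)) (binom-p (s≤s z≤n) k<p)) (zeroˡ _))))
    ... | tri≈ _ refl _ = trans (+-identityˡ _) (trans (coeff-monomial-≡ (suc k))
                            (sym (trans (cong₂ _*_ (binom-diag (suc k)) (cong (e ^_) (ℕ.n∸n≡0 k))) (*-identityˡ 1#))))
    ... | tri> _ k≢p p<k = trans (+-identityˡ _) (trans (coeff-monomial-≢ k≢p)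
                             (sym (trans (cong (_* e ^ (p ℕ.∸ suc k)) (binom-> p<k)) (zeroˡ _))))

  frobenius : ∀ x y → (x + y) ^ p ≡ x ^ p + y ^ p
  frobenius x y = begin
    (x + y) ^ p                                        ≡⟨ cong (_^ p) (solve 2 (λ x y → x :+ y := x :- (:- y)) refl x y) ⟩
    (x - - y) ^ p                                      ≡⟨ eval-powLin x p (- y) ⟨
    eval x (powLin p (- y))                            ≡⟨ eval-cong x (powLin-p (- y)) ⟩
    eval x (((0# - - y) ^ p ∷ []) ⊞ monomial p)        ≡⟨ eval-⊞ x ((0# - - y) ^ p ∷ []) (monomial p) ⟩
    ((0# - - y) ^ p + x * 0#) + eval x (monomial p)    ≡⟨ cong₂ _+_ (solve 2 (λ y′ x → y′ :+ x :* :0 := y′) refl ((0# - - y) ^ p) x) (eval-monomial x p) ⟩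
    (0# - - y) ^ p + x ^ p                             ≡⟨ cong (λ z → z ^ p + x ^ p) (solve 1 (λ y → :0 :- (:- y) := y) refl y) ⟩
    y ^ p + x ^ p                                      ≡⟨ +-comm _ _ ⟩
    x ^ p + y ^ p                                      ∎
    where open ≡-Reasoning

  fromℕ^p≡fromℕ : ∀ n → fromℕ n ^ p ≡ fromℕ n
  fromℕ^p≡fromℕ zero = 0^n≡0 (ℕ.<-trans (s≤s z≤n) 1<p)
    where
    0^n≡0 : ∀ {n} → 0 < n → 0# ^ n ≡ 0#
    0^n≡0 {suc n} _ = zeroˡ _
  fromℕ^p≡fromℕ (suc n) = begin
    fromℕ (suc n) ^ p         ≡⟨ cong (_^ p) (fromℕ-suc n) ⟩
    (1# + fromℕ n) ^ p        ≡⟨ frobenius 1# (fromℕ n) ⟩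
    1# ^ p + fromℕ n ^ p      ≡⟨ cong₂ _+_ (1^n≡1 p) (fromℕ^p≡fromℕ n) ⟩
    1# + fromℕ n              ≡⟨ fromℕ-suc n ⟨
    fromℕ (suc n)             ∎
    where open ≡-Reasoning

  x^p≡x : (∀ x → ∃[ n ] fromℕ n ≡ x) → ∀ x → x ^ p ≡ x
  x^p≡x generated x with generated x
  ... | n , refl = fromℕ^p≡fromℕ n

  fermat : (∀ x → ∃[ n ] fromℕ n ≡ x) → (∀ {x y} → x * y ≡ 0# → x ≡ 0# ⊎ y ≡ 0#) →
           ∀ {x} → x ≢ 0# → x ^ (p ℕ.∸ 1) ≡ 1#
  fermat generated integral {x} x≢0 with integral x[x^[p-1]-1]≡0
    where
    x[x^[p-1]-1]≡0 : x * (x ^ (p ℕ.∸ 1) - 1#) ≡ 0#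
    x[x^[p-1]-1]≡0 = begin
      x * (x ^ (p ℕ.∸ 1) - 1#)       ≡⟨ solve 2 (λ x y → x :* (y :- :1) := x :* y :- x) refl x (x ^ (p ℕ.∸ 1)) ⟩
      x * x ^ (p ℕ.∸ 1) - x          ≡⟨ cong (λ n → x ^ n - x) (ℕ.m+[n∸m]≡n (ℕ.<⇒≤ 1<p)) ⟩
      x ^ p - x                      ≡⟨ cong (_- x) (x^p≡x generated x) ⟩
      x - x                          ≡⟨ -‿inverseʳ x ⟩
      0#                             ∎
      where open ≡-Reasoning
  ... | inj₁ x≡0 = ⊥-elim (x≢0 x≡0)
  ... | inj₂ x^[p-1]-1≡0 = trans (solve 1 (λ y → y := (y :- :1) :+ :1) refl (x ^ (p ℕ.∸ 1)))
                                 (trans (cong (_+ 1#) x^[p-1]-1≡0) (+-identityˡ 1#))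

module PrimeField (p : ℕ) .{{_ : NonZero p}} (p>1 : 1 < p) where
  open import Data.Nat as ℕ using (ℕ; zero; suc; NonZero; _%_; _<_; _≤_; z≤n; s≤s)

  open import Algebra.Structures using (IsCommutativeRing)
  import Data.Nat.Properties as ℕ
  open import Data.Nat.DivMod using (%-distribˡ-+; %-distribˡ-*; m<n⇒m%n≡m; n%n≡0)
  open import Data.Nat.Divisibility using (_∣_; m%n≡0⇒n∣m; n∣m⇒m%n≡0)
  open import Data.Nat.Primality using (Prime; euclidsLemma)
  open import Data.Fin as Fin using (Fin; toℕ)
  open import Data.Fin.Properties using (toℕ-fromℕ<; toℕ-injective; toℕ<n)
  open import Data.Product using (_,_)
  open import Data.Sum using (_⊎_; inj₁; inj₂)
  open import Relation.Binary.PropositionalEquality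
  open import Defs
  open Rings using (CommRing; DecField; module Solver)

  private
    F = Fin p
    infixl 6 _⊕_
    infixl 7 _⊛_
    _⊕_ _⊛_ : F → F → F
    _⊕_ = _+F_ p
    _⊛_ = _*F_ p

  toℕ-ι : ∀ n → toℕ (ι p n) ≡ n % p
  toℕ-ι n = toℕ-fromℕ< _

  ι-toℕ : ∀ x → ι p (toℕ x) ≡ x
  ι-toℕ x = toℕ-injective (trans (toℕ-ι (toℕ x)) (m<n⇒m%n≡m (toℕ<n x)))

  ι-+ : ∀ m n → ι p (m ℕ.+ n) ≡ ι p m ⊕ ι p n
  ι-+ m n = toℕ-injective (begin
    toℕ (ι p (m ℕ.+ n))                     ≡⟨ toℕ-ι _ ⟩
    (m ℕ.+ n) % p                           ≡⟨ %-distribˡ-+ m n p ⟩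
    (m % p ℕ.+ n % p) % p                   ≡⟨ cong₂ (λ a b → (a ℕ.+ b) % p) (toℕ-ι m) (toℕ-ι n) ⟨
    (toℕ (ι p m) ℕ.+ toℕ (ι p n)) % p       ≡⟨ toℕ-ι _ ⟨
    toℕ (ι p m ⊕ ι p n)                     ∎)
    where open ≡-Reasoning

  ι-* : ∀ m n → ι p (m ℕ.* n) ≡ ι p m ⊛ ι p n
  ι-* m n = toℕ-injective (begin
    toℕ (ι p (m ℕ.* n))                     ≡⟨ toℕ-ι _ ⟩
    (m ℕ.* n) % p                           ≡⟨ %-distribˡ-* m n p ⟩
    (m % p ℕ.* (n % p)) % p                 ≡⟨ cong₂ (λ a b → (a ℕ.* b) % p) (toℕ-ι m) (toℕ-ι n) ⟨
    (toℕ (ι p m) ℕ.* toℕ (ι p n)) % p       ≡⟨ toℕ-ι _ ⟨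
    toℕ (ι p m ⊛ ι p n)                     ∎)
    where open ≡-Reasoning

  toℕ-ι-< : ∀ {n} → n < p → toℕ (ι p n) ≡ n
  toℕ-ι-< n<p = trans (toℕ-ι _) (m<n⇒m%n≡m n<p)

  toℕ-0F : toℕ (0F p) ≡ 0
  toℕ-0F = toℕ-ι-< (ℕ.<-trans (s≤s z≤n) p>1)

  ι-p≡0F : ι p p ≡ 0F p
  ι-p≡0F = toℕ-injective (trans (toℕ-ι p) (trans (n%n≡0 p) (sym toℕ-0F)))

  private
    ⊕-assoc : ∀ x y z → (x ⊕ y) ⊕ z ≡ x ⊕ (y ⊕ z)
    ⊕-assoc x y z = begin
      ι p (toℕ x ℕ.+ toℕ y) ⊕ z                 ≡⟨ cong (ι p (toℕ x ℕ.+ toℕ y) ⊕_) (ι-toℕ z) ⟨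
      ι p (toℕ x ℕ.+ toℕ y) ⊕ ι p (toℕ z)       ≡⟨ ι-+ _ _ ⟨
      ι p (toℕ x ℕ.+ toℕ y ℕ.+ toℕ z)           ≡⟨ cong (ι p) (ℕ.+-assoc (toℕ x) _ _) ⟩
      ι p (toℕ x ℕ.+ (toℕ y ℕ.+ toℕ z))         ≡⟨ ι-+ _ _ ⟩
      ι p (toℕ x) ⊕ (y ⊕ z)                     ≡⟨ cong (_⊕ (y ⊕ z)) (ι-toℕ x) ⟩
      x ⊕ (y ⊕ z)                               ∎
      where open ≡-Reasoning

    ⊛-assoc : ∀ x y z → (x ⊛ y) ⊛ z ≡ x ⊛ (y ⊛ z)
    ⊛-assoc x y z = begin
      ι p (toℕ x ℕ.* toℕ y) ⊛ z                 ≡⟨ cong (ι p (toℕ x ℕ.* toℕ y) ⊛_) (ι-toℕ z) ⟨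
      ι p (toℕ x ℕ.* toℕ y) ⊛ ι p (toℕ z)       ≡⟨ ι-* _ _ ⟨
      ι p (toℕ x ℕ.* toℕ y ℕ.* toℕ z)           ≡⟨ cong (ι p) (ℕ.*-assoc (toℕ x) _ _) ⟩
      ι p (toℕ x ℕ.* (toℕ y ℕ.* toℕ z))         ≡⟨ ι-* _ _ ⟩
      ι p (toℕ x) ⊛ (y ⊛ z)                     ≡⟨ cong (_⊛ (y ⊛ z)) (ι-toℕ x) ⟩
      x ⊛ (y ⊛ z)                               ∎
      where open ≡-Reasoning

    ⊕-comm : ∀ x y → x ⊕ y ≡ y ⊕ x
    ⊕-comm x y = cong (ι p) (ℕ.+-comm (toℕ x) (toℕ y))

    ⊛-comm : ∀ x y → x ⊛ y ≡ y ⊛ x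
    ⊛-comm x y = cong (ι p) (ℕ.*-comm (toℕ x) (toℕ y))

    ⊕-identityˡ : ∀ x → 0F p ⊕ x ≡ x
    ⊕-identityˡ x = trans (cong (0F p ⊕_) (sym (ι-toℕ x))) (trans (sym (ι-+ 0 (toℕ x))) (ι-toℕ x))

    ⊛-identityˡ : ∀ x → 1F p ⊛ x ≡ x
    ⊛-identityˡ x = begin
      1F p ⊛ x                  ≡⟨ cong (1F p ⊛_) (ι-toℕ x) ⟨
      ι p 1 ⊛ ι p (toℕ x)       ≡⟨ ι-* 1 (toℕ x) ⟨
      ι p (1 ℕ.* toℕ x)         ≡⟨ cong (ι p) (ℕ.*-identityˡ (toℕ x)) ⟩
      ι p (toℕ x)               ≡⟨ ι-toℕ x ⟩
      x                         ∎
      where open ≡-Reasoning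

    ⊛-distribˡ-⊕ : ∀ x y z → x ⊛ (y ⊕ z) ≡ x ⊛ y ⊕ x ⊛ z
    ⊛-distribˡ-⊕ x y z = begin
      x ⊛ (y ⊕ z)                                 ≡⟨ cong (_⊛ (y ⊕ z)) (ι-toℕ x) ⟨
      ι p (toℕ x) ⊛ ι p (toℕ y ℕ.+ toℕ z)         ≡⟨ ι-* _ _ ⟨
      ι p (toℕ x ℕ.* (toℕ y ℕ.+ toℕ z))           ≡⟨ cong (ι p) (ℕ.*-distribˡ-+ (toℕ x) _ _) ⟩
      ι p (toℕ x ℕ.* toℕ y ℕ.+ toℕ x ℕ.* toℕ z)   ≡⟨ ι-+ _ _ ⟩
      x ⊛ y ⊕ x ⊛ z                               ∎
      where open ≡-Reasoning

    ⊕-inverseʳ : ∀ x → x ⊕ (-F_ p x) ≡ 0F p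
    ⊕-inverseʳ x = begin
      x ⊕ (-F_ p x)                         ≡⟨ cong (_⊕ (-F_ p x)) (ι-toℕ x) ⟨
      ι p (toℕ x) ⊕ ι p (p ℕ.∸ toℕ x)       ≡⟨ ι-+ _ _ ⟨
      ι p (toℕ x ℕ.+ (p ℕ.∸ toℕ x))         ≡⟨ cong (ι p) (ℕ.m+[n∸m]≡n (ℕ.<⇒≤ (toℕ<n x))) ⟩
      ι p p                                 ≡⟨ ι-p≡0F ⟩
      0F p                                  ∎
      where open ≡-Reasoning

    isCommutativeRing : IsCommutativeRing _≡_ _⊕_ _⊛_ (-F_ p) (0F p) (1F p)
    isCommutativeRing = record
      { isRing = record
        { +-isAbelianGroup = record
          { isGroup = record
            { isMonoid = record
              { isSemigroup = record { isMagma = record { isEquivalence = isEquivalence ; ∙-cong = cong₂ _⊕_ }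
                                     ; assoc = ⊕-assoc }
              ; identity = ⊕-identityˡ , λ x → trans (⊕-comm x (0F p)) (⊕-identityˡ x) }
            ; inverse = (λ x → trans (⊕-comm (-F_ p x) x) (⊕-inverseʳ x)) , ⊕-inverseʳ
            ; ⁻¹-cong = cong (-F_ p) }
          ; comm = ⊕-comm }
        ; *-cong = cong₂ _⊛_
        ; *-assoc = ⊛-assoc
        ; *-identity = ⊛-identityˡ , λ x → trans (⊛-comm x (1F p)) (⊛-identityˡ x)
        ; distrib = ⊛-distribˡ-⊕ , λ x y z → trans (⊛-comm (y ⊕ z) x)
                                              (trans (⊛-distribˡ-⊕ x y z) (cong₂ _⊕_ (⊛-comm x y) (⊛-comm x z))) }
      ; *-comm = ⊛-comm }

  𝔽 : CommRing
  𝔽 = record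
    { Carrier = F ; _+_ = _⊕_ ; _*_ = _⊛_ ; -_ = -F_ p ; 0# = 0F p ; 1# = 1F p
    ; isCommutativeRing = isCommutativeRing }

  open CommRing 𝔽 using (0#; 1#)
  open Solver 𝔽 using (fromℕ; fromℕ-suc)
  open Polynomials 𝔽 using (_^_)

  fromℕ≡ι : ∀ n → fromℕ n ≡ ι p n
  fromℕ≡ι zero = refl
  fromℕ≡ι (suc n) = trans (fromℕ-suc n) (trans (cong (1# ⊕_) (fromℕ≡ι n)) (sym (ι-+ 1 n)))

  fromℕ-toℕ : ∀ x → fromℕ (toℕ x) ≡ x
  fromℕ-toℕ x = trans (fromℕ≡ι (toℕ x)) (ι-toℕ x)

  fromℕ-p : fromℕ p ≡ 0#
  fromℕ-p = trans (fromℕ≡ι p) ι-p≡0F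

  fromℕ-≢0 : ∀ {n} → 0 < n → n < p → fromℕ n ≢ 0#
  fromℕ-≢0 {suc n} _ n<p eq = ℕ.1+n≢0 (trans (sym (toℕ-ι-< n<p)) (trans (cong toℕ (trans (sym (fromℕ≡ι (suc n))) eq)) toℕ-0F))

  ^F≡^ : ∀ x k → _^F_ p x k ≡ x ^ k
  ^F≡^ x zero = refl
  ^F≡^ x (suc k) = trans (ι-* (toℕ x) _) (cong₂ _⊛_ (ι-toℕ x) (^F≡^ x k))

  1≢0 : 1# ≢ 0#
  1≢0 = fromℕ-≢0 (s≤s z≤n) p>1

  p∣toℕ⇒≡0 : ∀ x → p ∣ toℕ x → x ≡ 0#
  p∣toℕ⇒≡0 x p∣x = toℕ-injective (trans (sym (m<n⇒m%n≡m (toℕ<n x))) (trans (n∣m⇒m%n≡0 _ p p∣x) (sym toℕ-0F)))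

  integralDomain : Prime p → ∀ {x y} → x ⊛ y ≡ 0# → x ≡ 0# ⊎ y ≡ 0#
  integralDomain p-prime {x} {y} xy≡0 with euclidsLemma (toℕ x) (toℕ y) p-prime p∣xy
    where
    p∣xy : p ∣ toℕ x ℕ.* toℕ y
    p∣xy = m%n≡0⇒n∣m _ p (trans (sym (toℕ-ι _)) (trans (cong toℕ xy≡0) toℕ-0F))
  ... | inj₁ p∣x = inj₁ (p∣toℕ⇒≡0 x p∣x)
  ... | inj₂ p∣y = inj₂ (p∣toℕ⇒≡0 y p∣y)

  module _ (p-prime : Prime p) where
    fermat : ∀ {x} → x ≢ 0# → x ^ (p ℕ.∸ 1) ≡ 1#
    fermat = CharacteristicP.fermat 𝔽 p-prime fromℕ-p (λ x → toℕ x , fromℕ-toℕ x) (integralDomain p-prime)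

    invF-inverse : ∀ {x} → x ≢ 0# → x ⊛ invF p x ≡ 1#
    invF-inverse {x} x≢0 = begin
      x ⊛ invF p x                  ≡⟨ cong (x ⊛_) (^F≡^ x (p ℕ.∸ 2)) ⟩
      x ^ suc (p ℕ.∸ 2)             ≡⟨ cong (x ^_) (ℕ.+-∸-assoc 1 p>1) ⟨
      x ^ (p ℕ.∸ 1)                 ≡⟨ fermat x≢0 ⟩
      1#                            ∎
      where open ≡-Reasoning

    𝔽-field : DecField
    𝔽-field = record { commRing = 𝔽 ; _≟_ = Fin._≟_ ; inv = invF p ; inverseʳ = invF-inverse ; 1≢0 = 1≢0 }

module PolynomialsOverFields (F : DecField) where

  open import Relation.Binary.PropositionalEquality

  open import Data.Nat as ℕ using (ℕ; zero; suc; _≤_; _<_; z≤n; s≤s)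
  import Data.Nat.Properties as ℕ
  open import Data.List using (List; []; _∷_; length; replicate; _++_; foldr; map; filter)
  import Data.List.Properties as List
  open import Data.List.Relation.Unary.All as All using (All; []; _∷_)
  open import Data.List.Relation.Unary.AllPairs using ([]; _∷_)
  open import Data.List.Relation.Unary.Unique.Propositional using (Unique)
  open import Data.List.Relation.Unary.Any using (here; there)
  open import Data.List.Membership.Propositional using (_∈_)
  open import Data.Product using (_,_; proj₁; proj₂)
  open import Data.Sum using (_⊎_; inj₁; inj₂)
  open import Data.Unit using (tt)
  open import Data.Empty using (⊥-elim)
  open import Relation.Nullary using (yes; no; ¬?)
  import Relation.Unary

  open DecField F
  open Solver commRing
  open Polynomials commRing

  inverseˡ : ∀ {x} → x ≢ 0# → inv x * x ≡ 1#
  inverseˡ x≢0 = trans (*-comm _ _) (inverseʳ x≢0)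

  x*y≡0⇒y≡0 : ∀ {x y} → x ≢ 0# → x * y ≡ 0# → y ≡ 0#
  x*y≡0⇒y≡0 {x} {y} x≢0 xy≡0 = begin
    y                  ≡⟨ *-identityˡ y ⟨
    1# * y             ≡⟨ cong (_* y) (inverseˡ x≢0) ⟨
    (inv x * x) * y    ≡⟨ *-assoc _ _ _ ⟩
    inv x * (x * y)    ≡⟨ cong (inv x *_) xy≡0 ⟩
    inv x * 0#         ≡⟨ zeroʳ _ ⟩
    0#                 ∎
    where open ≡-Reasoning

  x*y≡0⇒x≡0∨y≡0 : ∀ {x y} → x * y ≡ 0# → x ≡ 0# ⊎ y ≡ 0#
  x*y≡0⇒x≡0∨y≡0 {x} xy≡0 with x ≟ 0#
  ... | yes x≡0 = inj₁ x≡0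
  ... | no x≢0 = inj₂ (x*y≡0⇒y≡0 x≢0 xy≡0)

  x*y≢0 : ∀ {x y} → x ≢ 0# → y ≢ 0# → x * y ≢ 0#
  x*y≢0 x≢0 y≢0 xy≡0 with x*y≡0⇒x≡0∨y≡0 xy≡0
  ... | inj₁ x≡0 = x≢0 x≡0
  ... | inj₂ y≡0 = y≢0 y≡0

  x*y≡z⇒y≡inv[x]*z : ∀ {x y z} → x ≢ 0# → x * y ≡ z → y ≡ inv x * z
  x*y≡z⇒y≡inv[x]*z {x} {y} {z} x≢0 xy≡z = begin
    y                  ≡⟨ *-identityˡ y ⟨
    1# * y             ≡⟨ cong (_* y) (inverseˡ x≢0) ⟨
    (inv x * x) * y    ≡⟨ *-assoc _ _ _ ⟩
    inv x * (x * y)    ≡⟨ cong (inv x *_) xy≡z ⟩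
    inv x * z          ∎
    where open ≡-Reasoning

  x-y≡0⇒x≡y : ∀ {x y} → x - y ≡ 0# → x ≡ y
  x-y≡0⇒x≡y {x} {y} x-y≡0 =
    trans (solve 2 (λ x y → x := (x :- y) :+ y) refl x y) (trans (cong (_+ y) x-y≡0) (+-identityˡ y))

  x≢y⇒x-y≢0 : ∀ {x y} → x ≢ y → x - y ≢ 0#
  x≢y⇒x-y≢0 x≢y = x≢y ∘ x-y≡0⇒x≡y
    where open import Function using (_∘_)

  *-cancelˡ : ∀ {x y z} → x ≢ 0# → x * y ≡ x * z → y ≡ z
  *-cancelˡ {x} {y} {z} x≢0 xy≡xz = x-y≡0⇒x≡y (x*y≡0⇒y≡0 x≢0
    (trans (solve 3 (λ x y z → x :* (y :- z) := x :* y :- x :* z) refl x y z)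
           (trans (cong (_- x * z) xy≡xz) (-‿inverseʳ _))))

  inverse-unique : ∀ {x y z} → x * y ≡ 1# → x * z ≡ 1# → y ≡ z
  inverse-unique {x} {y} {z} xy≡1 xz≡1 = begin
    y              ≡⟨ *-identityʳ y ⟨
    y * 1#         ≡⟨ cong (y *_) xz≡1 ⟨
    y * (x * z)    ≡⟨ solve 3 (λ x y z → y :* (x :* z) := (x :* y) :* z) refl x y z ⟩
    (x * y) * z    ≡⟨ cong (_* z) xy≡1 ⟩
    1# * z         ≡⟨ *-identityˡ z ⟩
    z              ∎
    where open ≡-Reasoning

  inv-square : ∀ {x} → x ≢ 0# → inv (x * x) ≡ inv x * inv x
  inv-square {x} x≢0 = inverse-unique (inverseʳ (x*y≢0 x≢0 x≢0))
    (trans (solve 2 (λ x y → (x :* x) :* (y :* y) := (x :* y) :* (x :* y)) refl x (inv x))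
           (trans (cong₂ _*_ (inverseʳ x≢0) (inverseʳ x≢0)) (*-identityˡ 1#)))

  -1≢0 : - 1# ≢ 0#
  -1≢0 -1≡0 = 1≢0 (begin
    1#          ≡⟨ solve 0 (:1 := :- (:- :1)) refl ⟩
    - (- 1#)    ≡⟨ cong -_ -1≡0 ⟩
    - 0#        ≡⟨ solve 0 (:- :0 := :0) refl ⟩
    0#          ∎)
    where open ≡-Reasoning

  x^n≢0 : ∀ {x} n → x ≢ 0# → x ^ n ≢ 0#
  x^n≢0 zero x≢0 = 1≢0
  x^n≢0 (suc n) x≢0 = x*y≢0 x≢0 (x^n≢0 n x≢0)

  x^d≡1⇒x≢0 : ∀ {x d} → 0 < d → x ^ d ≡ 1# → x ≢ 0#
  x^d≡1⇒x≢0 {x} {suc d} _ x^d≡1 x≡0 = 1≢0 (trans (sym x^d≡1) (trans (cong (_* x ^ d) x≡0) (zeroˡ _)))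

  x^d≡1⇒x^[d∸k]≡inv[x]^k : ∀ {x d} k → 0 < d → k ≤ d → x ^ d ≡ 1# → x ^ (d ℕ.∸ k) ≡ inv x ^ k
  x^d≡1⇒x^[d∸k]≡inv[x]^k {x} {d} k 0<d k≤d x^d≡1 = inverse-unique
    (trans (sym (^-homo-* x k (d ℕ.∸ k))) (trans (cong (x ^_) (ℕ.m+[n∸m]≡n k≤d)) x^d≡1))
    (trans (sym (^-distrib-* x (inv x) k)) (trans (cong (_^ k) (inverseʳ (x^d≡1⇒x≢0 0<d x^d≡1))) (1^n≡1 k)))

  binom-≢0 : ∀ {n k} → (∀ {m} → 0 < m → m ≤ n → fromℕ m ≢ 0#) → k ≤ n → binom n k ≢ 0#
  binom-≢0 {n} {zero} _ _ = 1≢0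
  binom-≢0 {suc n} {suc k} char (s≤s k≤n) binom≡0
    with x*y≡0⇒x≡0∨y≡0 (trans (sym (binom-absorb n k)) (trans (cong (fromℕ (suc k) *_) binom≡0) (zeroʳ _)))
  ... | inj₁ n+1≡0 = char (s≤s z≤n) ℕ.≤-refl n+1≡0
  ... | inj₂ nCk≡0 = binom-≢0 (λ 0<m m≤n → char 0<m (ℕ.m≤n⇒m≤1+n m≤n)) k≤n nCk≡0

  VanishesToOrder : Carrier → ℕ → Poly → Set
  VanishesToOrder b m P = ∀ j → j < m → taylor b P j ≡ 0#

  root⇒VanishesToOrder-1 : ∀ {b P} → eval b P ≡ 0# → VanishesToOrder b 1 P
  root⇒VanishesToOrder-1 root zero _ = root
  root⇒VanishesToOrder-1 root (suc j) (s≤s ())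

  taylor-root : ∀ b c P j → eval c P ≡ 0# → taylor b P j ≡ taylor b (mulLin c (quot c P)) j
  taylor-root b c P j root = begin
    taylor b P j                                                       ≡⟨ taylor-cong b j (division c P) ⟩
    taylor b (mulLin c (quot c P) ⊞ (eval c P ∷ [])) j                 ≡⟨ taylor-⊞ b j (mulLin c (quot c P)) (eval c P ∷ []) ⟩
    taylor b (mulLin c (quot c P)) j + taylor b (eval c P ∷ []) j      ≡⟨ cong (taylor b (mulLin c (quot c P)) j +_) (remainder j) ⟩
    taylor b (mulLin c (quot c P)) j + 0#                              ≡⟨ +-identityʳ _ ⟩
    taylor b (mulLin c (quot c P)) j                                   ∎
    where
    open ≡-Reasoning
    remainder : ∀ j → taylor b (eval c P ∷ []) j ≡ 0#
    remainder zero = trans (taylor-const-zero b _) root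
    remainder (suc j) = taylor-const-suc b (eval c P) j

  -- Dividing by x - c, for a root c ≠ b, divides every Taylor coefficient at b by b - c.
  quot-preserves-order : ∀ {b c m P} → b ≢ c → eval c P ≡ 0# → VanishesToOrder b m P → VanishesToOrder b m (quot c P)
  quot-preserves-order {b} {c} {m} {P} b≢c root vanishes = go
    where
    Q = quot c P
    b-c≢0 = x≢y⇒x-y≢0 b≢c
    go : VanishesToOrder b m Q
    go zero 0<m = x*y≡0⇒y≡0 b-c≢0
      (trans (sym (taylor-mulLin-zero b c Q)) (trans (sym (taylor-root b c P 0 root)) (vanishes 0 0<m)))
    go (suc j) j<m = x*y≡0⇒y≡0 b-c≢0 (begin
      (b - c) * taylor b Q (suc j)                 ≡⟨ +-identityˡ _ ⟨
      0# + (b - c) * taylor b Q (suc j)            ≡⟨ cong (_+ (b - c) * taylor b Q (suc j)) (go j (ℕ.<-trans (ℕ.n<1+n j) j<m)) ⟨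
      taylor b Q j + (b - c) * taylor b Q (suc j)  ≡⟨ taylor-mulLin-suc b c Q j ⟨
      taylor b (mulLin c Q) (suc j)                ≡⟨ taylor-root b c P (suc j) root ⟨
      taylor b P (suc j)                           ≡⟨ vanishes (suc j) j<m ⟩
      0#                                           ∎)
      where open ≡-Reasoning

  quot^-preserves-order : ∀ {b c m} k {P} → b ≢ c → VanishesToOrder c k P → VanishesToOrder b m P →
                          VanishesToOrder b m (quot^ c k P)
  quot^-preserves-order zero b≢c _ vanishes = vanishes
  quot^-preserves-order (suc k) b≢c vanishes-c vanishes-b = quot^-preserves-order k b≢c
    (λ j j<k → vanishes-c (suc j) (s≤s j<k)) (quot-preserves-order b≢c (vanishes-c 0 (s≤s z≤n)) vanishes-b)

  repeatEach : ℕ → List Carrier → List Carrier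
  repeatEach m [] = []
  repeatEach m (b ∷ B) = replicate m b ++ repeatEach m B

  length-repeatEach : ∀ m B → length (repeatEach m B) ≡ length B ℕ.* m
  length-repeatEach m [] = refl
  length-repeatEach m (b ∷ B) = trans (List.length-++ (replicate m b))
    (cong₂ ℕ._+_ (List.length-replicate m) (length-repeatEach m B))

  VanishesToOrder⇒HasRoots : ∀ {b} m {P} L → VanishesToOrder b m P → HasRoots (quot^ b m P) L →
                             HasRoots P (replicate m b ++ L)
  VanishesToOrder⇒HasRoots zero L _ roots = roots
  VanishesToOrder⇒HasRoots (suc m) L vanishes roots =
    vanishes 0 (s≤s z≤n) , VanishesToOrder⇒HasRoots m L (λ j j<m → vanishes (suc j) (s≤s j<m)) roots

  AllVanishToOrder⇒HasRoots : ∀ {m P B} → Unique B → All (λ b → VanishesToOrder b m P) B → HasRoots P (repeatEach m B)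
  AllVanishToOrder⇒HasRoots {B = []} [] [] = tt
  AllVanishToOrder⇒HasRoots {m} {P} {b ∷ B} (b∉B ∷ unique) (vanishes-b ∷ vanishes) =
    VanishesToOrder⇒HasRoots m (repeatEach m B) vanishes-b (AllVanishToOrder⇒HasRoots unique (remaining b∉B vanishes))
    where
    remaining : ∀ {B} → All (b ≢_) B → All (λ b′ → VanishesToOrder b′ m P) B →
                All (λ b′ → VanishesToOrder b′ m (quot^ b m P)) B
    remaining [] [] = []
    remaining (b≢b′ ∷ ≢s) (v ∷ vs) = quot^-preserves-order m (b≢b′ ∘ sym) vanishes-b v ∷ remaining ≢s vs
      where open import Function using (_∘_)

  vanishing⇒≈[] : ∀ {m n P B} → Unique B → All (λ b → VanishesToOrder b m P) B →
                  Deg< n P → n ≤ length B ℕ.* m → P ≈ []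
  vanishing⇒≈[] {m} {n} {P} {B} unique vanishes deg n≤Bm =
    tooManyRoots⇒≈[] (repeatEach m B) P n deg (subst (n ≤_) (sym (length-repeatEach m B)) n≤Bm)
      (AllVanishToOrder⇒HasRoots unique vanishes)

  vanishing-bound : ∀ {m n P B} → Unique B → All (λ b → VanishesToOrder b m P) B →
                    Deg< (suc n) P → coeff P n ≢ 0# → length B ℕ.* m ≤ n
  vanishing-bound {m} {n} {P} {B} unique vanishes deg top≢0 with length B ℕ.* m ℕ.≤? n
  ... | yes Bm≤n = Bm≤n
  ... | no Bm≰n = ⊥-elim (top≢0 (at (vanishing⇒≈[] unique vanishes deg (ℕ.≰⇒> Bm≰n)) n))

  monic-vanishing-bound : ∀ {m n P B} → Unique B → All (λ b → VanishesToOrder b m P) B →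
                          Monic n P → length B ℕ.* m ≤ n
  monic-vanishing-bound unique vanishes (deg , top) = vanishing-bound unique vanishes deg (λ top≡0 → 1≢0 (trans (sym top) top≡0))

  rootsOfUnity-bound : ∀ {d Z} → 0 < d → Unique Z → All (λ z → z ^ d ≡ 1#) Z → length Z ≤ d
  rootsOfUnity-bound {d} {Z} 0<d unique roots =
    subst (_≤ d) (ℕ.*-identityʳ (length Z)) (monic-vanishing-bound unique (All.map vanishes roots) monic)
    where
    P = monomial d ⊞ (- 1# ∷ [])
    const-coeff : ∀ {k} → 0 < k → coeff (- 1# ∷ []) k ≡ 0#
    const-coeff {suc k} _ = refl
    monic : Monic d P
    monic = (λ k d<k → trans (coeff-⊞ (monomial d) _ k) (trans (cong₂ _+_ (proj₁ (monomial-monic d) k d<k)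
                                                               (const-coeff (ℕ.≤-<-trans z≤n d<k))) (+-identityʳ 0#)))
          , trans (coeff-⊞ (monomial d) _ d) (trans (cong₂ _+_ (proj₂ (monomial-monic d)) (const-coeff 0<d)) (+-identityʳ 1#))
    vanishes : ∀ {z} → z ^ d ≡ 1# → VanishesToOrder z 1 P
    vanishes {z} z^d≡1 = root⇒VanishesToOrder-1 (begin
      eval z (monomial d ⊞ (- 1# ∷ []))           ≡⟨ eval-⊞ z (monomial d) _ ⟩
      eval z (monomial d) + (- 1# + z * 0#)       ≡⟨ cong₂ _+_ (trans (eval-monomial z d) z^d≡1) (solve 1 (λ z → :- :1 :+ z :* :0 := :- :1) refl z) ⟩
      1# - 1#                                     ≡⟨ -‿inverseʳ 1# ⟩
      0#                                          ∎)
      where open ≡-Reasoning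

  geometric : ℕ → ℕ → Poly
  geometric d zero = 1# ∷ []
  geometric d (suc k) = (1# ∷ []) ⊞ shift d (geometric d k)

  geometric-monic : ∀ {d} k → 0 < d → Monic (k ℕ.* d) (geometric d k)
  geometric-monic zero _ = 1-monic
  geometric-monic {d} (suc k) 0<d = deg , top
    where
    h = geometric d k
    IH = geometric-monic k 0<d
    const-coeff : ∀ {j} → 0 < j → coeff (1# ∷ []) j ≡ 0#
    const-coeff {suc j} _ = refl
    deg : Deg< (suc (suc k ℕ.* d)) (geometric d (suc k))
    deg j d+kd<j = trans (coeff-⊞ (1# ∷ []) (shift d h) j)
      (trans (cong₂ _+_ (const-coeff (ℕ.≤-<-trans z≤n d+kd<j))
                        (trans (coeff-shift d h (ℕ.≤-trans (ℕ.m≤m+n d (k ℕ.* d)) (ℕ.<⇒≤ d+kd<j)))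
                               (proj₁ IH (j ℕ.∸ d) (ℕ.≤-trans (ℕ.≤-reflexive (sym (ℕ.m+n∸m≡n d _)))
                                                             (ℕ.∸-monoˡ-≤ d (ℕ.≤-trans (ℕ.≤-reflexive (ℕ.+-suc d _)) d+kd<j))))))
             (+-identityʳ 0#))
    top : coeff (geometric d (suc k)) (d ℕ.+ k ℕ.* d) ≡ 1#
    top = trans (coeff-⊞ (1# ∷ []) (shift d h) (d ℕ.+ k ℕ.* d))
      (trans (cong₂ _+_ (const-coeff (ℕ.<-≤-trans 0<d (ℕ.m≤m+n d _)))
                        (trans (coeff-shift d h (ℕ.m≤m+n d _)) (trans (cong (coeff h) (ℕ.m+n∸m≡n d _)) (proj₂ IH))))
             (+-identityˡ 1#))

  eval-geometric : ∀ x d k → (x ^ d - 1#) * eval x (geometric d k) ≡ x ^ (suc k ℕ.* d) - 1#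
  eval-geometric x d zero = begin
    (x ^ d - 1#) * eval x (1# ∷ [])    ≡⟨ cong ((x ^ d - 1#) *_) (taylor-const-zero x 1#) ⟩
    (x ^ d - 1#) * 1#                  ≡⟨ *-identityʳ _ ⟩
    x ^ d - 1#                         ≡⟨ cong (λ n → x ^ n - 1#) (ℕ.+-identityʳ d) ⟨
    x ^ (d ℕ.+ 0) - 1#                 ∎
    where open ≡-Reasoning
  eval-geometric x d (suc k) = begin
    (y - 1#) * eval x ((1# ∷ []) ⊞ shift d h)          ≡⟨ cong ((y - 1#) *_) (eval-⊞ x (1# ∷ []) (shift d h)) ⟩
    (y - 1#) * (eval x (1# ∷ []) + eval x (shift d h))  ≡⟨ cong₂ (λ u v → (y - 1#) * (u + v)) (taylor-const-zero x 1#) (eval-shift x d h) ⟩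
    (y - 1#) * (1# + y * eval x h)                      ≡⟨ solve 2 (λ y h → (y :- :1) :* (:1 :+ y :* h) := y :- :1 :+ y :* ((y :- :1) :* h)) refl y (eval x h) ⟩
    y - 1# + y * ((y - 1#) * eval x h)                  ≡⟨ cong (λ z → y - 1# + y * z) (eval-geometric x d k) ⟩
    y - 1# + y * (x ^ (suc k ℕ.* d) - 1#)               ≡⟨ solve 2 (λ y z → y :- :1 :+ y :* (z :- :1) := y :* z :- :1) refl y (x ^ (suc k ℕ.* d)) ⟩
    y * x ^ (suc k ℕ.* d) - 1#                          ≡⟨ cong (_- 1#) (^-homo-* x d (suc k ℕ.* d)) ⟨
    x ^ (suc (suc k) ℕ.* d) - 1#                        ∎
    where
    open ≡-Reasoning
    y = x ^ d
    h = geometric d k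

  -- (∏ₗ (x - l)) · (1 + xᵈ + ⋯ + xᵏᵈ) is monic of degree |L| + kd and vanishes on U.
  rootsOfUnity-lowerBound : ∀ {d} k {U L} → 0 < d → Unique U → length U ≡ suc k ℕ.* d →
                            All (λ u → u ^ (suc k ℕ.* d) ≡ 1#) U → All (λ u → u ^ d ≡ 1# → u ∈ L) U → d ≤ length L
  rootsOfUnity-lowerBound {d} k {U} {L} 0<d unique length-U roots covered =
    ℕ.+-cancelʳ-≤ (k ℕ.* d) d (length L) (subst (_≤ length L ℕ.+ k ℕ.* d) (trans (ℕ.*-identityʳ _) length-U) bound)
    where
    E = prodLinOn L (geometric d k)
    vanishes : ∀ {u} → u ^ (suc k ℕ.* d) ≡ 1# → (u ^ d ≡ 1# → u ∈ L) → VanishesToOrder u 1 E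
    vanishes {u} u^[k+1]d≡1 u∈L = root⇒VanishesToOrder-1 (trans (eval-prodLinOn u L (geometric d k)) (root (u ^ d ≟ 1#)))
      where
      open import Relation.Nullary using (Dec)
      root : Dec (u ^ d ≡ 1#) → eval u (prodLin L) * eval u (geometric d k) ≡ 0#
      root (yes u^d≡1) = trans (cong (_* _) (eval-prodLin-root u L (u∈L u^d≡1))) (zeroˡ _)
      root (no u^d≢1) = trans (cong (eval u (prodLin L) *_) (x*y≡0⇒y≡0 (u^d≢1 ∘ x-y≡0⇒x≡y)
                          (trans (eval-geometric u d k) (trans (cong (_- 1#) u^[k+1]d≡1) (-‿inverseʳ 1#))))) (zeroʳ _)
        where open import Function using (_∘_)
    bound : length U ℕ.* 1 ≤ length L ℕ.+ k ℕ.* d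
    bound = monic-vanishing-bound unique (All.zipWith (λ (r , c) → vanishes r c) (roots , covered))
              (prodLinOn-monic L (k ℕ.* d) (geometric d k) (geometric-monic k 0<d))

  sum : List Carrier → Carrier
  sum = foldr _+_ 0#

  sum-++ : ∀ xs ys → sum (xs ++ ys) ≡ sum xs + sum ys
  sum-++ [] ys = sym (+-identityˡ _)
  sum-++ (x ∷ xs) ys = trans (cong (x +_) (sum-++ xs ys)) (sym (+-assoc _ _ _))

  product : List Carrier → Carrier
  product = foldr _*_ 1#

  product-++ : ∀ xs ys → product (xs ++ ys) ≡ product xs * product ys
  product-++ [] ys = sym (*-identityˡ _)
  product-++ (x ∷ xs) ys = trans (cong (x *_) (product-++ xs ys)) (sym (*-assoc _ _ _))

  weightedSum : List Carrier → List Carrier → (Carrier → Carrier) → Carrier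
  weightedSum [] W g = 0#
  weightedSum (c ∷ C) [] g = 0#
  weightedSum (c ∷ C) (w ∷ W) g = w * g c + weightedSum C W g

  weightedSum-cong : ∀ C W {g h} → All (λ c → g c ≡ h c) C → weightedSum C W g ≡ weightedSum C W h
  weightedSum-cong [] W _ = refl
  weightedSum-cong (c ∷ C) [] _ = refl
  weightedSum-cong (c ∷ C) (w ∷ W) (gc≡hc ∷ eqs) = cong₂ (λ x y → w * x + y) gc≡hc (weightedSum-cong C W eqs)

  weightedSum-linear : ∀ C W g h a b →
                       weightedSum C W (λ x → a * g x + b * h x) ≡ a * weightedSum C W g + b * weightedSum C W h
  weightedSum-linear [] W g h a b = solve 2 (λ a b → :0 := a :* :0 :+ b :* :0) refl a b
  weightedSum-linear (c ∷ C) [] g h a b = solve 2 (λ a b → :0 := a :* :0 :+ b :* :0) refl a b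
  weightedSum-linear (c ∷ C) (w ∷ W) g h a b = trans (cong (w * (a * g c + b * h c) +_) (weightedSum-linear C W g h a b))
    (solve 7 (λ w a b x y X Y → w :* (a :* x :+ b :* y) :+ (a :* X :+ b :* Y) := a :* (w :* x :+ X) :+ b :* (w :* y :+ Y))
       refl w a b (g c) (h c) (weightedSum C W g) (weightedSum C W h))

  weightedSum-scale : ∀ C W g a → weightedSum C W (λ x → a * g x) ≡ a * weightedSum C W g
  weightedSum-scale [] W g a = sym (zeroʳ a)
  weightedSum-scale (c ∷ C) [] g a = sym (zeroʳ a)
  weightedSum-scale (c ∷ C) (w ∷ W) g a = trans (cong (w * (a * g c) +_) (weightedSum-scale C W g a))
    (solve 4 (λ w a x X → w :* (a :* x) :+ a :* X := a :* (w :* x :+ X)) refl w a (g c) (weightedSum C W g))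

  divideWeights : Carrier → List Carrier → List Carrier → List Carrier
  divideWeights c [] W = []
  divideWeights c (c′ ∷ C) [] = []
  divideWeights c (c′ ∷ C) (w ∷ W) = w * inv (c′ - c) ∷ divideWeights c C W

  weightedSum-divideWeights : ∀ c f C W → All (c ≢_) C →
    weightedSum C (divideWeights c C W) (λ x → eval x f)
      ≡ weightedSum C W (λ x → eval x (quot c f)) + sum (divideWeights c C W) * eval c f
  weightedSum-divideWeights c f [] W _ = solve 1 (λ e → :0 := :0 :+ :0 :* e) refl (eval c f)
  weightedSum-divideWeights c f (c′ ∷ C) [] _ = solve 1 (λ e → :0 := :0 :+ :0 :* e) refl (eval c f)
  weightedSum-divideWeights c f (c′ ∷ C) (w ∷ W) (c≢c′ ∷ c≢C) = begin
    (w * i) * eval c′ f + weightedSum C (divideWeights c C W) g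
      ≡⟨ cong₂ (λ x y → (w * i) * x + y) (eval-division c′ c f) (weightedSum-divideWeights c f C W c≢C) ⟩
    (w * i) * ((c′ - c) * q + e) + (weightedSum C W h + S * e)
      ≡⟨ solve 7 (λ w i d q e X S → (w :* i) :* (d :* q :+ e) :+ (X :+ S :* e) := w :* q :* (d :* i) :+ X :+ (w :* i :+ S) :* e)
           refl w i (c′ - c) q e (weightedSum C W h) S ⟩
    w * q * ((c′ - c) * i) + weightedSum C W h + (w * i + S) * e
      ≡⟨ cong (λ z → w * q * z + weightedSum C W h + (w * i + S) * e) (inverseʳ (x≢y⇒x-y≢0 (c≢c′ ∘ sym))) ⟩
    w * q * 1# + weightedSum C W h + (w * i + S) * e
      ≡⟨ cong (λ z → z + weightedSum C W h + (w * i + S) * e) (*-identityʳ _) ⟩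
    w * q + weightedSum C W h + (w * i + S) * e ∎
    where
    open ≡-Reasoning
    open import Function using (_∘_)
    i = inv (c′ - c)
    g = λ x → eval x f
    h = λ x → eval x (quot c f)
    q = eval c′ (quot c f)
    e = eval c f
    S = sum (divideWeights c C W)

  -- w_c = 1 / ∏_{c′ ≠ c} (c - c′), computed one point at a time.
  lagrangeWeights : List Carrier → List Carrier
  lagrangeWeights [] = []
  lagrangeWeights (c ∷ []) = 1# ∷ []
  lagrangeWeights (c ∷ C@(_ ∷ _)) = - sum (divideWeights c C (lagrangeWeights C)) ∷ divideWeights c C (lagrangeWeights C)

  lagrange-leadingCoeff : ∀ c C f → Unique (c ∷ C) → Deg< (suc (length C)) f →
                          weightedSum (c ∷ C) (lagrangeWeights (c ∷ C)) (λ x → eval x f) ≡ coeff f (length C)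
  lagrange-leadingCoeff c [] f _ deg = trans (+-identityʳ _) (trans (*-identityˡ _) (eval-Deg<1 c f deg))
  lagrange-leadingCoeff c (c₂ ∷ C) f (c∉C ∷ unique) deg = begin
    - S * eval c f + weightedSum (c₂ ∷ C) (divideWeights c (c₂ ∷ C) W) g
      ≡⟨ cong (- S * eval c f +_) (weightedSum-divideWeights c f (c₂ ∷ C) W c∉C) ⟩
    - S * eval c f + (weightedSum (c₂ ∷ C) W h + S * eval c f)
      ≡⟨ solve 3 (λ S e X → (:- S) :* e :+ (X :+ S :* e) := X) refl S (eval c f) (weightedSum (c₂ ∷ C) W h) ⟩
    weightedSum (c₂ ∷ C) W h
      ≡⟨ lagrange-leadingCoeff c₂ C (quot c f) unique (Deg<-quot c (suc (length C)) f deg) ⟩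
    coeff (quot c f) (length C)
      ≡⟨ coeff-quot-top c (length C) f deg ⟩
    coeff f (suc (length C)) ∎
    where
    open ≡-Reasoning
    W = lagrangeWeights (c₂ ∷ C)
    S = sum (divideWeights c (c₂ ∷ C) W)
    g = λ x → eval x f
    h = λ x → eval x (quot c f)

  two : Carrier
  two = 1# + 1#

  offProduct : Carrier → List Carrier → Carrier
  offProduct b O = product (map (λ l → b - l) O)

  invSum : Carrier → List Carrier → Carrier
  invSum b O = sum (map (λ l → inv (b - l)) O)

  invSqSum : Carrier → List Carrier → Carrier
  invSqSum b O = sum (map (λ l → inv ((b - l) * (b - l))) O)

  -- Meant for P = ∏ₗ (x - l), where b occurs z times among the l and O lists the other l.
  record TaylorHead (b : Carrier) (P : Poly) (z : ℕ) (O : List Carrier) : Set where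
    field
      vanishes : VanishesToOrder b z P
      head₀ : taylor b P z ≡ offProduct b O
      head₁ : taylor b P (suc z) ≡ offProduct b O * invSum b O
      head₂ : two * taylor b P (suc (suc z)) ≡ offProduct b O * (invSum b O * invSum b O - invSqSum b O)

  taylorHead-1 : ∀ b → TaylorHead b (1# ∷ []) 0 []
  taylorHead-1 b = record
    { vanishes = λ _ ()
    ; head₀ = taylor-const-zero b 1#
    ; head₁ = trans (taylor-const-suc b 1# 0) (sym (zeroʳ 1#))
    ; head₂ = trans (cong (two *_) (taylor-const-suc b 1# 1)) (solve 1 (λ t → t :* :0 := :1 :* (:0 :* :0 :- :0)) refl two) }

  taylorHead-mulLin-self : ∀ {b P z O} → TaylorHead b P z O → TaylorHead b (mulLin b P) (suc z) O
  taylorHead-mulLin-self {b} {P} {z} T = record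
    { vanishes = vanishes′
    ; head₀ = trans (taylor-mulLin-self b P z) head₀
    ; head₁ = trans (taylor-mulLin-self b P (suc z)) head₁
    ; head₂ = trans (cong (two *_) (taylor-mulLin-self b P (suc (suc z)))) head₂ }
    where
    open TaylorHead T
    vanishes′ : VanishesToOrder b (suc z) (mulLin b P)
    vanishes′ zero _ = trans (taylor-mulLin-zero b b P) (solve 2 (λ b t → (b :- b) :* t := :0) refl b (taylor b P 0))
    vanishes′ (suc j) (s≤s j<z) = trans (taylor-mulLin-self b P j) (vanishes j j<z)

  taylorHead-mulLin : ∀ {b l P z O} → l ≢ b → TaylorHead b P z O → TaylorHead b (mulLin l P) z (l ∷ O)
  taylorHead-mulLin {b} {l} {P} {z} {O} l≢b T = record
    { vanishes = vanishes′
    ; head₀ = trans (first z vanishes) (cong (e *_) head₀)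
    ; head₁ = head₁′
    ; head₂ = head₂′ }
    where
    open TaylorHead T
    open ≡-Reasoning
    e = b - l
    i = inv e
    π = offProduct b O
    s = invSum b O
    s₂ = invSqSum b O
    e≢0 : e ≢ 0#
    e≢0 = x≢y⇒x-y≢0 (l≢b ∘ sym)
      where open import Function using (_∘_)
    e*i≡1 : e * i ≡ 1#
    e*i≡1 = inverseʳ e≢0
    vanishes′ : VanishesToOrder b z (mulLin l P)
    vanishes′ zero 0<z = trans (taylor-mulLin-zero b l P) (trans (cong (e *_) (vanishes 0 0<z)) (zeroʳ e))
    vanishes′ (suc j) j<z = trans (taylor-mulLin-suc b l P j)
      (trans (cong₂ (λ x y → x + e * y) (vanishes j (ℕ.<-trans (ℕ.n<1+n j) j<z)) (vanishes (suc j) j<z))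
             (solve 1 (λ e → :0 :+ e :* :0 := :0) refl e))
    first : ∀ z → VanishesToOrder b z P → taylor b (mulLin l P) z ≡ e * taylor b P z
    first zero _ = taylor-mulLin-zero b l P
    first (suc k) vanishes = trans (taylor-mulLin-suc b l P k)
      (trans (cong (_+ e * taylor b P (suc k)) (vanishes k (ℕ.n<1+n k))) (+-identityˡ _))
    head₁′ : taylor b (mulLin l P) (suc z) ≡ (e * π) * (i + s)
    head₁′ = begin
      taylor b (mulLin l P) (suc z)              ≡⟨ taylor-mulLin-suc b l P z ⟩
      taylor b P z + e * taylor b P (suc z)      ≡⟨ cong₂ (λ x y → x + e * y) head₀ head₁ ⟩
      π + e * (π * s)                            ≡⟨ cong (_+ e * (π * s)) (*-identityˡ π) ⟨
      1# * π + e * (π * s)                       ≡⟨ cong (λ t → t * π + e * (π * s)) e*i≡1 ⟨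
      (e * i) * π + e * (π * s)                  ≡⟨ solve 4 (λ e i π s → (e :* i) :* π :+ e :* (π :* s) := (e :* π) :* (i :+ s)) refl e i π s ⟩
      (e * π) * (i + s)                          ∎
    head₂′ : two * taylor b (mulLin l P) (suc (suc z)) ≡ (e * π) * ((i + s) * (i + s) - (inv (e * e) + s₂))
    head₂′ = begin
      two * taylor b (mulLin l P) (suc (suc z))
        ≡⟨ cong (two *_) (taylor-mulLin-suc b l P (suc z)) ⟩
      two * (taylor b P (suc z) + e * y)
        ≡⟨ cong (λ t → two * (t + e * y)) head₁ ⟩
      two * (π * s + e * y)
        ≡⟨ solve 4 (λ π s e y → (:1 :+ :1) :* (π :* s :+ e :* y) := (:1 :+ :1) :* π :* s :+ e :* ((:1 :+ :1) :* y)) refl π s e y ⟩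
      two * π * s + e * (two * y)
        ≡⟨ cong (λ t → two * π * s + e * t) head₂ ⟩
      two * π * s + e * (π * (s * s - s₂))
        ≡⟨ cong (_+ e * (π * (s * s - s₂))) (*-identityʳ _) ⟨
      two * π * s * 1# + e * (π * (s * s - s₂))
        ≡⟨ cong (λ t → two * π * s * t + e * (π * (s * s - s₂))) e*i≡1 ⟨
      two * π * s * (e * i) + e * (π * (s * s - s₂))
        ≡⟨ solve 5 (λ e i π s s₂ → (:1 :+ :1) :* π :* s :* (e :* i) :+ e :* (π :* (s :* s :- s₂))
                                   := (e :* π) :* ((i :+ s) :* (i :+ s) :- (i :* i :+ s₂))) refl e i π s s₂ ⟩
      (e * π) * ((i + s) * (i + s) - (i * i + s₂))
        ≡⟨ cong (λ t → (e * π) * ((i + s) * (i + s) - (t + s₂))) (inv-square e≢0) ⟨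
      (e * π) * ((i + s) * (i + s) - (inv (e * e) + s₂)) ∎
      where y = taylor b P (suc (suc z))

  others : Carrier → List Carrier → List Carrier
  others b = filter (λ l → ¬? (l ≟ b))

  multiplicity : Carrier → List Carrier → ℕ
  multiplicity b L = length (filter (_≟ b) L)

  prodLin-taylorHead : ∀ b L → TaylorHead b (prodLin L) (multiplicity b L) (others b L)
  prodLin-taylorHead b [] = taylorHead-1 b
  prodLin-taylorHead b (l ∷ L) with l ≟ b
  ... | yes refl = taylorHead-mulLin-self (prodLin-taylorHead b L)
  ... | no l≢b = taylorHead-mulLin l≢b (prodLin-taylorHead b L)

  copies : ℕ → List Carrier → List Carrier
  copies zero B = []
  copies (suc n) B = B ++ copies n B

  length-copies : ∀ n B → length (copies n B) ≡ n ℕ.* length B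
  length-copies zero B = refl
  length-copies (suc n) B = trans (List.length-++ B) (cong (length B ℕ.+_) (length-copies n B))

  filter-copies : ∀ {P : Carrier → Set} (P? : Relation.Unary.Decidable P) n B → filter P? (copies n B) ≡ copies n (filter P? B)
  filter-copies P? zero B = refl
  filter-copies P? (suc n) B = trans (List.filter-++ P? B (copies n B)) (cong (filter P? B ++_) (filter-copies P? n B))

  sum-map-copies : ∀ (f : Carrier → Carrier) n O → sum (map f (copies n O)) ≡ fromℕ n * sum (map f O)
  sum-map-copies f zero O = sym (zeroˡ _)
  sum-map-copies f (suc n) O = begin
    sum (map f (O ++ copies n O))                 ≡⟨ cong sum (List.map-++ f O (copies n O)) ⟩
    sum (map f O ++ map f (copies n O))           ≡⟨ sum-++ (map f O) _ ⟩
    sum (map f O) + sum (map f (copies n O))      ≡⟨ cong (sum (map f O) +_) (sum-map-copies f n O) ⟩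
    sum (map f O) + fromℕ n * sum (map f O)       ≡⟨ solve 2 (λ m x → x :+ m :* x := (:1 :+ m) :* x) refl (fromℕ n) (sum (map f O)) ⟩
    (1# + fromℕ n) * sum (map f O)                ≡⟨ cong (_* sum (map f O)) (fromℕ-suc n) ⟨
    fromℕ (suc n) * sum (map f O)                 ∎
    where open ≡-Reasoning

  offProduct-copies : ∀ b n O → offProduct b (copies n O) ≡ offProduct b O ^ n
  offProduct-copies b zero O = refl
  offProduct-copies b (suc n) O = begin
    product (map (λ l → b - l) (O ++ copies n O))                   ≡⟨ cong product (List.map-++ (λ l → b - l) O (copies n O)) ⟩
    product (map (λ l → b - l) O ++ map (λ l → b - l) (copies n O))        ≡⟨ product-++ (map (λ l → b - l) O) _ ⟩
    offProduct b O * offProduct b (copies n O)               ≡⟨ cong (offProduct b O *_) (offProduct-copies b n O) ⟩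
    offProduct b O * offProduct b O ^ n                      ∎
    where open ≡-Reasoning

  multiplicity-∉ : ∀ {b L} → All (_≢ b) L → multiplicity b L ≡ 0
  multiplicity-∉ {b} ≢b = cong length (List.filter-none (_≟ b) ≢b)

  others-∉ : ∀ {b L} → All (_≢ b) L → others b L ≡ L
  others-∉ {b} ≢b = List.filter-all (λ l → ¬? (l ≟ b)) ≢b

  multiplicity-unique : ∀ {b L} → Unique L → b ∈ L → multiplicity b L ≡ 1
  multiplicity-unique {b} {b ∷ L} (b∉L ∷ _) (here refl) rewrite List.filter-accept (_≟ b) {xs = L} refl =
    cong suc (multiplicity-∉ (All.map (_∘ sym) b∉L))
    where open import Function using (_∘_)
  multiplicity-unique {b} {l ∷ L} (l∉L ∷ unique) (there b∈L) rewrite List.filter-reject (_≟ b) {xs = L} (All.lookup l∉L b∈L) =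
    multiplicity-unique unique b∈L

-- Evaluating Q / (x - b)ʲ on C expresses the moments M k through the Taylor coefficients of Q at b.
module PartialFractions (F : DecField) (c₀ : DecField.Carrier F) (C₀ : List (DecField.Carrier F))
                        (unique : Unique (c₀ ∷ C₀)) (b : DecField.Carrier F) (b∉C : All (_≢ b) (c₀ ∷ C₀)) where
  open import Relation.Binary.PropositionalEquality
  open import Data.List using (List; _∷_; length)
  open import Data.List.Relation.Unary.All as All using (All)
  open import Data.List.Relation.Unary.Unique.Propositional using (Unique)

  open import Data.Nat as ℕ using (ℕ; suc)
  import Data.Nat.Properties as ℕ
  open import Data.List.Membership.Propositional using (_∈_)
  open import Data.Product using (proj₁; proj₂)
  open import Function using (_∘_)

  open DecField F
  open Solver commRing
  open Polynomials commRing
  open PolynomialsOverFields F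

  C = c₀ ∷ C₀
  W = lagrangeWeights C
  α′ = length C₀

  Q : Poly
  Q = prodLin C

  t : ℕ → Carrier
  t j = taylor b Q j

  u : Carrier → Carrier
  u c = inv (b - c)

  M : ℕ → Carrier
  M k = weightedSum C W (λ c → u c ^ k)

  S₁ S₂ : Carrier
  S₁ = invSum b C
  S₂ = invSqSum b C

  Q-head : TaylorHead b Q 0 C
  Q-head = subst₂ (TaylorHead b Q) (multiplicity-∉ b∉C) (others-∉ b∉C) (prodLin-taylorHead b C)

  private
    b-c≢0 : ∀ {c} → c ∈ C → b - c ≢ 0#
    b-c≢0 c∈C = x≢y⇒x-y≢0 (All.lookup b∉C c∈C ∘ sym)

    quotient : ℕ → Poly
    quotient j = quot^ b j Q

    eval-quotient-suc : ∀ {c} → c ∈ C → ∀ j → eval c (quotient (suc j)) ≡ u c * t j - u c * eval c (quotient j)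
    eval-quotient-suc {c} c∈C j = begin
      eval c (quotient (suc j))                       ≡⟨ cong (eval c) (quot^-suc b j Q) ⟩
      r                                               ≡⟨ *-identityˡ r ⟨
      1# * r                                          ≡⟨ cong (_* r) (inverseˡ (b-c≢0 c∈C)) ⟨
      (u c * (b - c)) * r                             ≡⟨ solve 4 (λ u e r t → (u :* e) :* r := u :* t :- u :* ((:- e) :* r :+ t)) refl (u c) (b - c) r (t j) ⟩
      u c * t j - u c * ((- (b - c)) * r + t j)       ≡⟨ cong (λ z → u c * t j - u c * (z * r + t j)) (solve 2 (λ b c → :- (b :- c) := c :- b) refl b c) ⟩
      u c * t j - u c * ((c - b) * r + t j)           ≡⟨ cong (λ z → u c * t j - u c * z) (eval-division c b (quotient j)) ⟨
      u c * t j - u c * eval c (quotient j)           ∎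
      where
      open ≡-Reasoning
      r = eval c (quot b (quotient j))

    eval-quotient-1 : ∀ {c} → c ∈ C → eval c (quotient 1) ≡ t 0 * u c ^ 1
    eval-quotient-1 {c} c∈C = trans (eval-quotient-suc c∈C 0) (trans (cong (λ z → u c * t 0 - u c * z) (eval-prodLin-root c C c∈C))
      (solve 2 (λ u t → u :* t :- u :* :0 := t :* (u :* :1)) refl (u c) (t 0)))

    eval-quotient-2 : ∀ {c} → c ∈ C → eval c (quotient 2) ≡ t 1 * u c ^ 1 + (- t 0) * u c ^ 2
    eval-quotient-2 {c} c∈C = trans (eval-quotient-suc c∈C 1) (trans (cong (λ z → u c * t 1 - u c * z) (eval-quotient-1 c∈C))
      (solve 3 (λ u t₀ t₁ → u :* t₁ :- u :* (t₀ :* (u :* :1)) := t₁ :* (u :* :1) :+ (:- t₀) :* (u :* (u :* :1))) refl (u c) (t 0) (t 1)))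

    eval-quotient-3 : ∀ {c} → c ∈ C → eval c (quotient 3) ≡ 1# * (t 2 * u c ^ 1 + (- t 1) * u c ^ 2) + t 0 * u c ^ 3
    eval-quotient-3 {c} c∈C = trans (eval-quotient-suc c∈C 2) (trans (cong (λ z → u c * t 2 - u c * z) (eval-quotient-2 c∈C))
      (solve 4 (λ u t₀ t₁ t₂ → u :* t₂ :- u :* (t₁ :* (u :* :1) :+ (:- t₀) :* (u :* (u :* :1)))
                               := :1 :* (t₂ :* (u :* :1) :+ (:- t₁) :* (u :* (u :* :1))) :+ t₀ :* (u :* (u :* (u :* :1)))) refl (u c) (t 0) (t 1) (t 2)))

    Q-monic : Monic (suc α′) Q
    Q-monic = prodLin-monic C

    deg-quotient-1 : Deg< (suc α′) (quotient 1)
    deg-quotient-1 = Deg<-quot b (suc α′) Q (proj₁ Q-monic)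

    deg-quotient-2 : Deg< α′ (quotient 2)
    deg-quotient-2 = Deg<-quot b α′ (quotient 1) deg-quotient-1

    deg-quotient-3 : Deg< (α′ ℕ.∸ 1) (quotient 3)
    deg-quotient-3 = Deg<-quot b (α′ ℕ.∸ 1) (quotient 2) (Deg<-mono (quotient 2) (ℕ.m≤n+m∸n α′ 1) deg-quotient-2)

    lagrange : ∀ P → Deg< (suc α′) P → weightedSum C W (λ c → eval c P) ≡ coeff P α′
    lagrange P = lagrange-leadingCoeff c₀ C₀ P unique

    tabulate-C : ∀ {g h : Carrier → Carrier} → (∀ {c} → c ∈ C → g c ≡ h c) → All (λ c → g c ≡ h c) C
    tabulate-C = All.tabulate

    t₀M₁≡1 : t 0 * M 1 ≡ 1#
    t₀M₁≡1 = begin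
      t 0 * M 1                                        ≡⟨ weightedSum-scale C W (λ c → u c ^ 1) (t 0) ⟨
      weightedSum C W (λ c → t 0 * u c ^ 1)            ≡⟨ weightedSum-cong C W (tabulate-C eval-quotient-1) ⟨
      weightedSum C W (λ c → eval c (quotient 1))      ≡⟨ lagrange (quotient 1) deg-quotient-1 ⟩
      coeff (quotient 1) α′                            ≡⟨ coeff-quot-top b α′ Q (proj₁ Q-monic) ⟩
      coeff Q (suc α′)                                 ≡⟨ proj₂ Q-monic ⟩
      1#                                               ∎
      where open ≡-Reasoning

    t₁M₁-t₀M₂≡0 : t 1 * M 1 + (- t 0) * M 2 ≡ 0#
    t₁M₁-t₀M₂≡0 = begin
      t 1 * M 1 + (- t 0) * M 2                                          ≡⟨ weightedSum-linear C W (λ c → u c ^ 1) (λ c → u c ^ 2) (t 1) (- t 0) ⟨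
      weightedSum C W (λ c → t 1 * u c ^ 1 + (- t 0) * u c ^ 2)          ≡⟨ weightedSum-cong C W (tabulate-C eval-quotient-2) ⟨
      weightedSum C W (λ c → eval c (quotient 2))                        ≡⟨ lagrange (quotient 2) (Deg<-mono (quotient 2) (ℕ.n≤1+n α′) deg-quotient-2) ⟩
      coeff (quotient 2) α′                                              ≡⟨ deg-quotient-2 α′ ℕ.≤-refl ⟩
      0#                                                                 ∎
      where open ≡-Reasoning

    t₂M₁-t₁M₂+t₀M₃≡0 : 1# * (t 2 * M 1 + (- t 1) * M 2) + t 0 * M 3 ≡ 0#
    t₂M₁-t₁M₂+t₀M₃≡0 = begin
      1# * (t 2 * M 1 + (- t 1) * M 2) + t 0 * M 3
        ≡⟨ cong (λ z → 1# * z + t 0 * M 3) (weightedSum-linear C W (λ c → u c ^ 1) (λ c → u c ^ 2) (t 2) (- t 1)) ⟨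
      1# * weightedSum C W (λ c → t 2 * u c ^ 1 + (- t 1) * u c ^ 2) + t 0 * M 3
        ≡⟨ weightedSum-linear C W (λ c → t 2 * u c ^ 1 + (- t 1) * u c ^ 2) (λ c → u c ^ 3) 1# (t 0) ⟨
      weightedSum C W (λ c → 1# * (t 2 * u c ^ 1 + (- t 1) * u c ^ 2) + t 0 * u c ^ 3)
        ≡⟨ weightedSum-cong C W (tabulate-C eval-quotient-3) ⟨
      weightedSum C W (λ c → eval c (quotient 3))
        ≡⟨ lagrange (quotient 3) (Deg<-mono (quotient 3) (ℕ.≤-trans (ℕ.m∸n≤m α′ 1) (ℕ.n≤1+n α′)) deg-quotient-3) ⟩
      coeff (quotient 3) α′
        ≡⟨ deg-quotient-3 α′ (ℕ.m∸n≤m α′ 1) ⟩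
      0# ∎
      where open ≡-Reasoning

  t₀≢0 : t 0 ≢ 0#
  t₀≢0 t₀≡0 = 1≢0 (trans (sym t₀M₁≡1) (trans (cong (_* M 1) t₀≡0) (zeroˡ _)))

  M₁≢0 : M 1 ≢ 0#
  M₁≢0 M₁≡0 = 1≢0 (trans (sym t₀M₁≡1) (trans (cong (t 0 *_) M₁≡0) (zeroʳ _)))

  private
    t₁≡t₀S₁ : t 1 ≡ t 0 * S₁
    t₁≡t₀S₁ = trans (TaylorHead.head₁ Q-head) (cong (_* S₁) (sym (TaylorHead.head₀ Q-head)))

    2t₂≡t₀[S₁²-S₂] : two * t 2 ≡ t 0 * (S₁ * S₁ - S₂)
    2t₂≡t₀[S₁²-S₂] = trans (TaylorHead.head₂ Q-head) (cong (_* (S₁ * S₁ - S₂)) (sym (TaylorHead.head₀ Q-head)))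

  M₂≡S₁M₁ : M 2 ≡ S₁ * M 1
  M₂≡S₁M₁ = sym (x-y≡0⇒x≡y (x*y≡0⇒y≡0 t₀≢0 (begin
    t 0 * (S₁ * M 1 - M 2)                  ≡⟨ solve 4 (λ t₀ S m₁ m₂ → t₀ :* (S :* m₁ :- m₂) := (t₀ :* S) :* m₁ :+ (:- t₀) :* m₂) refl (t 0) S₁ (M 1) (M 2) ⟩
    (t 0 * S₁) * M 1 + (- t 0) * M 2        ≡⟨ cong (λ x → x * M 1 + (- t 0) * M 2) t₁≡t₀S₁ ⟨
    t 1 * M 1 + (- t 0) * M 2               ≡⟨ t₁M₁-t₀M₂≡0 ⟩
    0#                                      ∎)))
    where open ≡-Reasoning

  2M₃≡[S₁²+S₂]M₁ : two * M 3 ≡ (S₁ * S₁ + S₂) * M 1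
  2M₃≡[S₁²+S₂]M₁ = x-y≡0⇒x≡y (x*y≡0⇒y≡0 t₀≢0 (begin
    t 0 * (two * M 3 - (S₁ * S₁ + S₂) * M 1)
      ≡⟨ solve 5 (λ t₀ S S₂ m₁ m₃ → t₀ :* ((:1 :+ :1) :* m₃ :- (S :* S :+ S₂) :* m₁)
                                    := (t₀ :* (S :* S :- S₂)) :* m₁ :+ (:- (:1 :+ :1)) :* (t₀ :* S) :* (S :* m₁) :+ (:1 :+ :1) :* t₀ :* m₃)
           refl (t 0) S₁ S₂ (M 1) (M 3) ⟩
    (t 0 * (S₁ * S₁ - S₂)) * M 1 + (- two) * (t 0 * S₁) * (S₁ * M 1) + two * t 0 * M 3
      ≡⟨ cong₂ (λ x y → x * M 1 + (- two) * y * (S₁ * M 1) + two * t 0 * M 3) 2t₂≡t₀[S₁²-S₂] t₁≡t₀S₁ ⟨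
    (two * t 2) * M 1 + (- two) * t 1 * (S₁ * M 1) + two * t 0 * M 3
      ≡⟨ cong (λ x → (two * t 2) * M 1 + (- two) * t 1 * x + two * t 0 * M 3) M₂≡S₁M₁ ⟨
    (two * t 2) * M 1 + (- two) * t 1 * M 2 + two * t 0 * M 3
      ≡⟨ solve 7 (λ w t₀ t₁ t₂ m₁ m₂ m₃ → (w :* t₂) :* m₁ :+ (:- w) :* t₁ :* m₂ :+ w :* t₀ :* m₃
                                            := w :* (:1 :* (t₂ :* m₁ :+ (:- t₁) :* m₂) :+ t₀ :* m₃))
           refl two (t 0) (t 1) (t 2) (M 1) (M 2) (M 3) ⟩
    two * (1# * (t 2 * M 1 + (- t 1) * M 2) + t 0 * M 3)
      ≡⟨ cong (two *_) t₂M₁-t₁M₂+t₀M₃≡0 ⟩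
    two * 0#
      ≡⟨ zeroʳ two ⟩
    0# ∎))
    where open ≡-Reasoning

module Sumsets (F : DecField) where

  open import Relation.Binary.PropositionalEquality
  open import Data.Nat as ℕ using (ℕ; zero; suc; _≤_; _<_; z≤n; s≤s)
  open import Data.List using (List; []; _∷_; length; filter)
  open import Data.List.Membership.Propositional using (_∈_)
  open import Data.List.Relation.Unary.Unique.Propositional using (Unique)
  import Data.Nat.Properties as ℕ
  open import Data.List.Relation.Unary.All as All using (All)
  open import Data.Product using (_,_; proj₁; proj₂)
  open import Data.Sum using (inj₁; inj₂)
  open import Relation.Nullary using (¬?)

  open DecField F
  open Solver commRing
  open Polynomials commRing
  open PolynomialsOverFields F

  module RootsOfUnity (d : ℕ) (c₀ : Carrier) (C₀ B : List Carrier)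
    (unique-C : Unique (c₀ ∷ C₀)) (unique-B : Unique B)
    (0<α′ : 0 < length C₀) (1<β : 1 < length B) (0<d : 0 < d)
    (roots : ∀ {c b} → c ∈ c₀ ∷ C₀ → b ∈ B → (b - c) ^ d ≡ 1#)
    (char : ∀ {n} → 0 < n → n ≤ d ℕ.+ length C₀ → fromℕ n ≢ 0#)
    (d≤αβ : d ≤ suc (length C₀) ℕ.* length B) where

    C = c₀ ∷ C₀
    W = lagrangeWeights C
    α′ = length C₀
    α = suc α′
    β = length B
    N = d ℕ.+ α′

    sign : Carrier
    sign = (- 1#) ^ α′

    sign≢0 : sign ≢ 0#
    sign≢0 = x^n≢0 α′ -1≢0

    powerMoment : ∀ b m → m ≤ α′ → weightedSum C W (λ c → (b - c) ^ m) ≡ (- 1#) ^ m * (binom m α′ * (0# - b) ^ (m ℕ.∸ α′))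
    powerMoment b m m≤α′ = begin
      weightedSum C W (λ c → (b - c) ^ m)                   ≡⟨ weightedSum-cong C W (All.universal flip-sign C) ⟩
      weightedSum C W (λ c → (- 1#) ^ m * eval c f)         ≡⟨ weightedSum-scale C W (λ c → eval c f) ((- 1#) ^ m) ⟩
      (- 1#) ^ m * weightedSum C W (λ c → eval c f)         ≡⟨ cong ((- 1#) ^ m *_) (lagrange-leadingCoeff c₀ C₀ f unique-C (Deg<-mono f (s≤s m≤α′) (proj₁ (powLin-monic m b)))) ⟩
      (- 1#) ^ m * coeff f α′                               ≡⟨ cong ((- 1#) ^ m *_) (trans (sym (taylor-at-0 α′ f)) (taylor-powLin 0# m b α′)) ⟩
      (- 1#) ^ m * (binom m α′ * (0# - b) ^ (m ℕ.∸ α′))     ∎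
      where
      open ≡-Reasoning
      f = powLin m b
      flip-sign : ∀ c → (b - c) ^ m ≡ (- 1#) ^ m * eval c f
      flip-sign c = trans (cong (_^ m) (solve 2 (λ b c → b :- c := (:- :1) :* (c :- b)) refl b c))
                          (trans (^-distrib-* (- 1#) (c - b) m) (cong ((- 1#) ^ m *_) (sym (eval-powLin c m b))))

    powerMoment-< : ∀ b {m} → m < α′ → weightedSum C W (λ c → (b - c) ^ m) ≡ 0#
    powerMoment-< b {m} m<α′ = trans (powerMoment b m (ℕ.<⇒≤ m<α′))
      (trans (cong (λ z → (- 1#) ^ m * (z * (0# - b) ^ (m ℕ.∸ α′))) (binom-> m<α′))
             (trans (cong ((- 1#) ^ m *_) (zeroˡ _)) (zeroʳ _)))

    powerMoment-top : ∀ b → weightedSum C W (λ c → (b - c) ^ α′) ≡ sign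
    powerMoment-top b = trans (powerMoment b α′ ℕ.≤-refl)
      (trans (cong₂ (λ x y → sign * (x * (0# - b) ^ y)) (binom-diag α′) (ℕ.n∸n≡0 α′))
             (trans (cong (sign *_) (*-identityˡ 1#)) (*-identityʳ sign)))

    weightedPowers : List Carrier → List Carrier → Poly
    weightedPowers [] W = []
    weightedPowers (c ∷ C) [] = []
    weightedPowers (c ∷ C) (w ∷ W) = scale w (powLin N c) ⊞ weightedPowers C W

    G : Poly
    G = weightedPowers C W ⊞ (- sign ∷ [])

    taylor-weightedPowers : ∀ b j C W → taylor b (weightedPowers C W) j ≡ binom N j * weightedSum C W (λ c → (b - c) ^ (N ℕ.∸ j))
    taylor-weightedPowers b j [] W = trans (taylor-≈[] b j [] ≈-refl) (sym (zeroʳ _))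
    taylor-weightedPowers b j (c ∷ C) [] = trans (taylor-≈[] b j [] ≈-refl) (sym (zeroʳ _))
    taylor-weightedPowers b j (c ∷ C) (w ∷ W) = begin
      taylor b (scale w (powLin N c) ⊞ weightedPowers C W) j
        ≡⟨ taylor-⊞ b j (scale w (powLin N c)) (weightedPowers C W) ⟩
      taylor b (scale w (powLin N c)) j + taylor b (weightedPowers C W) j
        ≡⟨ cong₂ _+_ (trans (taylor-scale b j w (powLin N c)) (cong (w *_) (taylor-powLin b N c j))) (taylor-weightedPowers b j C W) ⟩
      w * (binom N j * (b - c) ^ (N ℕ.∸ j)) + binom N j * weightedSum C W (λ c → (b - c) ^ (N ℕ.∸ j))
        ≡⟨ solve 4 (λ w k e s → w :* (k :* e) :+ k :* s := k :* (w :* e :+ s)) refl w (binom N j) ((b - c) ^ (N ℕ.∸ j)) _ ⟩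
      binom N j * (w * (b - c) ^ (N ℕ.∸ j) + weightedSum C W (λ c → (b - c) ^ (N ℕ.∸ j))) ∎
      where open ≡-Reasoning

    taylor-G : ∀ b j → taylor b G j ≡ binom N j * weightedSum C W (λ c → (b - c) ^ (N ℕ.∸ j)) + taylor b (- sign ∷ []) j
    taylor-G b j = trans (taylor-⊞ b j (weightedPowers C W) (- sign ∷ [])) (cong (_+ taylor b (- sign ∷ []) j) (taylor-weightedPowers b j C W))

    taylor-G-pos : ∀ b {j} → 0 < j → taylor b G j ≡ binom N j * weightedSum C W (λ c → (b - c) ^ (N ℕ.∸ j))
    taylor-G-pos b {suc j} _ = trans (taylor-G b (suc j))
      (trans (cong (binom N (suc j) * weightedSum C W (λ c → (b - c) ^ (N ℕ.∸ suc j)) +_) (taylor-const-suc b (- sign) j)) (+-identityʳ _))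

    N∸[1+k]<α′ : ∀ {k} → d < suc k → N ℕ.∸ suc k < α′
    N∸[1+k]<α′ {k} d<1+k = begin-strict
      N ℕ.∸ suc k          ≤⟨ ℕ.∸-monoʳ-≤ N d<1+k ⟩
      N ℕ.∸ suc d          ≡⟨ cong (N ℕ.∸_) (ℕ.+-comm 1 d) ⟩
      N ℕ.∸ (d ℕ.+ 1)      ≡⟨ ℕ.[m+n]∸[m+o]≡n∸o d α′ 1 ⟩
      α′ ℕ.∸ 1             <⟨ ℕ.≤-reflexive (ℕ.m+[n∸m]≡n 0<α′) ⟩
      α′                   ∎
      where open ℕ.≤-Reasoning

    G-deg : Deg< (suc d) G
    G-deg zero ()
    G-deg (suc k) d<1+k = begin
      coeff G (suc k)                                                         ≡⟨ taylor-at-0 (suc k) G ⟨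
      taylor 0# G (suc k)                                                     ≡⟨ taylor-G-pos 0# (s≤s z≤n) ⟩
      binom N (suc k) * weightedSum C W (λ c → (0# - c) ^ (N ℕ.∸ suc k))      ≡⟨ cong (binom N (suc k) *_) (powerMoment-< 0# (N∸[1+k]<α′ d<1+k)) ⟩
      binom N (suc k) * 0#                                                    ≡⟨ zeroʳ _ ⟩
      0#                                                                      ∎
      where open ≡-Reasoning

    G-top : coeff G d ≡ binom N d * sign
    G-top = begin
      coeff G d                                                    ≡⟨ taylor-at-0 d G ⟨
      taylor 0# G d                                                ≡⟨ taylor-G-pos 0# 0<d ⟩
      binom N d * weightedSum C W (λ c → (0# - c) ^ (N ℕ.∸ d))     ≡⟨ cong (λ n → binom N d * weightedSum C W (λ c → (0# - c) ^ n)) (ℕ.m+n∸m≡n d α′) ⟩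
      binom N d * weightedSum C W (λ c → (0# - c) ^ α′)            ≡⟨ cong (binom N d *_) (powerMoment-top 0#) ⟩
      binom N d * sign                                             ∎
      where open ≡-Reasoning

    binom-N-≢0 : ∀ {j} → j ≤ N → binom N j ≢ 0#
    binom-N-≢0 = binom-≢0 char

    G-top≢0 : coeff G d ≢ 0#
    G-top≢0 = subst (_≢ 0#) (sym G-top) (x*y≢0 (binom-N-≢0 (ℕ.m≤m+n d α′)) sign≢0)

    -- On C, (b - c)ᵈ = 1 lowers the exponent N - j of G's Taylor coefficients at b ∈ B by d.
    weightedSum-reduce : ∀ {b} → b ∈ B → ∀ {j} → j ≤ α′ →
                         weightedSum C W (λ c → (b - c) ^ (N ℕ.∸ j)) ≡ weightedSum C W (λ c → (b - c) ^ (α′ ℕ.∸ j))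
    weightedSum-reduce {b} b∈B {j} j≤α′ = weightedSum-cong C W (All.tabulate λ {c} c∈C → begin
      (b - c) ^ (N ℕ.∸ j)                        ≡⟨ cong ((b - c) ^_) (ℕ.+-∸-assoc d j≤α′) ⟩
      (b - c) ^ (d ℕ.+ (α′ ℕ.∸ j))               ≡⟨ ^-homo-* (b - c) d (α′ ℕ.∸ j) ⟩
      (b - c) ^ d * (b - c) ^ (α′ ℕ.∸ j)         ≡⟨ cong (_* _) (roots c∈C b∈B) ⟩
      1# * (b - c) ^ (α′ ℕ.∸ j)                  ≡⟨ *-identityˡ _ ⟩
      (b - c) ^ (α′ ℕ.∸ j)                       ∎)
      where open ≡-Reasoning

    G-vanishes : ∀ {b} → b ∈ B → VanishesToOrder b α G
    G-vanishes {b} b∈B zero _ = begin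
      taylor b G 0                                                          ≡⟨ taylor-G b 0 ⟩
      1# * weightedSum C W (λ c → (b - c) ^ N) + taylor b (- sign ∷ []) 0   ≡⟨ cong₂ (λ x y → 1# * x + y) (trans (weightedSum-reduce b∈B z≤n) (powerMoment-top b)) (taylor-const-zero b (- sign)) ⟩
      1# * sign - sign                                                      ≡⟨ solve 1 (λ s → :1 :* s :- s := :0) refl sign ⟩
      0#                                                                    ∎
      where open ≡-Reasoning
    G-vanishes {b} b∈B (suc j) (s≤s j<α′) = begin
      taylor b G (suc j)                                                    ≡⟨ taylor-G-pos b (s≤s z≤n) ⟩
      binom N (suc j) * weightedSum C W (λ c → (b - c) ^ (N ℕ.∸ suc j))     ≡⟨ cong (binom N (suc j) *_) (weightedSum-reduce b∈B j<α′) ⟩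
      binom N (suc j) * weightedSum C W (λ c → (b - c) ^ (α′ ℕ.∸ suc j))    ≡⟨ cong (binom N (suc j) *_) (powerMoment-< b (ℕ.∸-monoʳ-< (s≤s z≤n) j<α′)) ⟩
      binom N (suc j) * 0#                                                  ≡⟨ zeroʳ _ ⟩
      0#                                                                    ∎
      where open ≡-Reasoning

    βα≤d : β ℕ.* α ≤ d
    βα≤d = vanishing-bound unique-B (All.tabulate G-vanishes) G-deg G-top≢0

    βα≡d : β ℕ.* α ≡ d
    βα≡d = ℕ.≤-antisym βα≤d (subst (d ≤_) (ℕ.*-comm α β) d≤αβ)

    4≤d : 4 ≤ d
    4≤d = ℕ.≤-trans (ℕ.*-mono-≤ {2} {β} {2} {α} 1<β (s≤s 0<α′)) βα≤d

    W′ : Poly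
    W′ = prodLin (copies α B)

    W′-monic : Monic d W′
    W′-monic = subst (λ n → Monic n W′) (trans (length-copies α B) (trans (ℕ.*-comm α β) βα≡d)) (prodLin-monic (copies α B))

    W′-head : ∀ {b} → b ∈ B → TaylorHead b W′ α (copies α (others b B))
    W′-head {b} b∈B = subst₂ (TaylorHead b W′) multiplicity-b (filter-copies (λ l → ¬? (l ≟ b)) α B) (prodLin-taylorHead b (copies α B))
      where
      multiplicity-b : multiplicity b (copies α B) ≡ α
      multiplicity-b = trans (cong length (filter-copies (_≟ b) α B))
        (trans (length-copies α (filter (_≟ b) B)) (trans (cong (α ℕ.*_) (multiplicity-unique unique-B b∈B)) (ℕ.*-identityʳ α)))

    κ : Carrier
    κ = coeff G d

    -- G - κ W′ has degree < d = βα but vanishes to order α on B.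
    taylor-G≡κW′ : ∀ b j → taylor b G j ≡ κ * taylor b W′ j
    taylor-G≡κW′ b j = begin
      taylor b G j                                             ≡⟨ solve 3 (λ x k y → x := (x :+ (:- k) :* y) :+ k :* y) refl (taylor b G j) κ (taylor b W′ j) ⟩
      (taylor b G j + (- κ) * taylor b W′ j) + κ * taylor b W′ j  ≡⟨ cong (_+ κ * taylor b W′ j) (trans (sym (taylor-H b j)) (taylor-≈[] b j H H≈[])) ⟩
      0# + κ * taylor b W′ j                                   ≡⟨ +-identityˡ _ ⟩
      κ * taylor b W′ j                                        ∎
      where
      open ≡-Reasoning
      H = G ⊞ scale (- κ) W′
      coeff-H : ∀ k → coeff H k ≡ coeff G k + (- κ) * coeff W′ k
      coeff-H k = trans (coeff-⊞ G (scale (- κ) W′) k) (cong (coeff G k +_) (coeff-scale (- κ) W′ k))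
      taylor-H : ∀ b j → taylor b H j ≡ taylor b G j + (- κ) * taylor b W′ j
      taylor-H b j = trans (taylor-⊞ b j G (scale (- κ) W′)) (cong (taylor b G j +_) (taylor-scale b j (- κ) W′))
      H-deg : Deg< d H
      H-deg k d≤k with ℕ.m≤n⇒m<n∨m≡n d≤k
      ... | inj₁ d<k = trans (coeff-H k) (trans (cong₂ (λ x y → x + (- κ) * y) (G-deg k d<k) (proj₁ W′-monic k d<k))
                                                (solve 1 (λ k → :0 :+ (:- k) :* :0 := :0) refl κ))
      ... | inj₂ refl = trans (coeff-H d) (trans (cong (λ y → κ + (- κ) * y) (proj₂ W′-monic))
                                                (solve 1 (λ k → k :+ (:- k) :* :1 := :0) refl κ))
      H-vanishes : ∀ {b} → b ∈ B → VanishesToOrder b α H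
      H-vanishes b∈B j j<α = trans (taylor-H _ j) (trans (cong₂ (λ x y → x + (- κ) * y) (G-vanishes b∈B j j<α) (TaylorHead.vanishes (W′-head b∈B) j j<α))
                                                       (solve 1 (λ k → :0 :+ (:- k) :* :0 := :0) refl κ))
      H≈[] : H ≈ []
      H≈[] = vanishing⇒≈[] unique-B (All.tabulate H-vanishes) H-deg (ℕ.≤-reflexive (sym βα≡d))

    N∸[k+α′]≡d∸k : ∀ k → N ℕ.∸ (k ℕ.+ α′) ≡ d ℕ.∸ k
    N∸[k+α′]≡d∸k k = trans (cong₂ ℕ._∸_ (ℕ.+-comm d α′) (ℕ.+-comm k α′)) (ℕ.[m+n]∸[m+o]≡n∸o α′ d k)

    fromℕ-≢0 : ∀ {n} → 0 < n → n ≤ d → fromℕ n ≢ 0#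
    fromℕ-≢0 0<n n≤d = char 0<n (ℕ.≤-trans n≤d (ℕ.m≤m+n d α′))

    module _ {b : Carrier} (b∈B : b ∈ B) where

      private
        b∉C : All (_≢ b) C
        b∉C = All.tabulate λ c∈C c≡b → x^d≡1⇒x≢0 0<d (roots c∈C b∈B) (trans (cong (λ x → b - x) c≡b) (-‿inverseʳ b))

      open PartialFractions F c₀ C₀ unique-C b b∉C public using (M; S₁; S₂; M₁≢0; M₂≡S₁M₁; 2M₃≡[S₁²+S₂]M₁)

      O = others b B
      π = offProduct b O
      T₁ = invSum b O
      T₂ = invSqSum b O

      taylor-G-high : ∀ k → 0 < k → k ≤ d → taylor b G (k ℕ.+ α′) ≡ binom N (k ℕ.+ α′) * M k
      taylor-G-high k 0<k k≤d = trans (taylor-G-pos b (ℕ.≤-trans 0<k (ℕ.m≤m+n k α′)))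
        (cong (binom N (k ℕ.+ α′) *_) (weightedSum-cong C W (All.tabulate λ {c} c∈C →
          trans (cong ((b - c) ^_) (N∸[k+α′]≡d∸k k)) (x^d≡1⇒x^[d∸k]≡inv[x]^k k 0<d k≤d (roots c∈C b∈B)))))

      private
        module W′b = TaylorHead (W′-head b∈B)

        G-head₀ : binom N α * M 1 ≡ κ * π ^ α
        G-head₀ = begin
          binom N α * M 1                  ≡⟨ taylor-G-high 1 (s≤s z≤n) 0<d ⟨
          taylor b G α                     ≡⟨ taylor-G≡κW′ b α ⟩
          κ * taylor b W′ α                ≡⟨ cong (κ *_) (trans W′b.head₀ (offProduct-copies b α O)) ⟩
          κ * π ^ α                        ∎
          where open ≡-Reasoning

        G-head₁ : binom N (suc α) * M 2 ≡ κ * (π ^ α * (fromℕ α * T₁))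
        G-head₁ = begin
          binom N (suc α) * M 2                                              ≡⟨ taylor-G-high 2 (s≤s z≤n) (ℕ.≤-trans (s≤s (s≤s z≤n)) 4≤d) ⟨
          taylor b G (suc α)                                                 ≡⟨ taylor-G≡κW′ b (suc α) ⟩
          κ * taylor b W′ (suc α)                                            ≡⟨ cong (κ *_) W′b.head₁ ⟩
          κ * (offProduct b (copies α O) * invSum b (copies α O))            ≡⟨ cong₂ (λ x y → κ * (x * y)) (offProduct-copies b α O) (sum-map-copies _ α O) ⟩
          κ * (π ^ α * (fromℕ α * T₁))                                       ∎
          where open ≡-Reasoning

        G-head₂ : two * (binom N (suc (suc α)) * M 3) ≡ κ * (π ^ α * ((fromℕ α * T₁) * (fromℕ α * T₁) - fromℕ α * T₂))
        G-head₂ = begin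
          two * (binom N (suc (suc α)) * M 3)         ≡⟨ cong (two *_) (taylor-G-high 3 (s≤s z≤n) (ℕ.≤-trans (s≤s (s≤s (s≤s z≤n))) 4≤d)) ⟨
          two * taylor b G (suc (suc α))              ≡⟨ cong (two *_) (taylor-G≡κW′ b (suc (suc α))) ⟩
          two * (κ * taylor b W′ (suc (suc α)))       ≡⟨ solve 3 (λ t k y → t :* (k :* y) := k :* (t :* y)) refl two κ (taylor b W′ (suc (suc α))) ⟩
          κ * (two * taylor b W′ (suc (suc α)))       ≡⟨ cong (κ *_) W′b.head₂ ⟩
          κ * (offProduct b (copies α O) * (invSum b (copies α O) * invSum b (copies α O) - invSqSum b (copies α O)))
            ≡⟨ cong₂ (λ x y → κ * (x * (y * y - invSqSum b (copies α O)))) (offProduct-copies b α O) (sum-map-copies _ α O) ⟩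
          κ * (π ^ α * ((fromℕ α * T₁) * (fromℕ α * T₁) - invSqSum b (copies α O)))
            ≡⟨ cong (λ z → κ * (π ^ α * ((fromℕ α * T₁) * (fromℕ α * T₁) - z))) (sum-map-copies _ α O) ⟩
          κ * (π ^ α * ((fromℕ α * T₁) * (fromℕ α * T₁) - fromℕ α * T₂)) ∎
          where open ≡-Reasoning

        ratio₁ : fromℕ (suc α) * binom N (suc α) ≡ fromℕ (d ℕ.∸ 1) * binom N α
        ratio₁ = trans (binom-ratio (ℕ.+-monoˡ-< α′ (ℕ.≤-trans (s≤s (s≤s z≤n)) 4≤d))) (cong (λ n → fromℕ n * binom N α) (N∸[k+α′]≡d∸k 1))

        ratio₂ : fromℕ (suc (suc α)) * binom N (suc (suc α)) ≡ fromℕ (d ℕ.∸ 2) * binom N (suc α)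
        ratio₂ = trans (binom-ratio (ℕ.+-monoˡ-< α′ (ℕ.≤-trans (s≤s (s≤s (s≤s z≤n))) 4≤d))) (cong (λ n → fromℕ n * binom N (suc α)) (N∸[k+α′]≡d∸k 2))

        K : Carrier
        K = binom N α * M 1

        K≢0 : K ≢ 0#
        K≢0 = x*y≢0 (binom-N-≢0 (ℕ.+-monoˡ-≤ α′ 0<d)) M₁≢0

        cleared₁ : fromℕ (d ℕ.∸ 1) * S₁ ≡ fromℕ (suc α) * fromℕ α * T₁
        cleared₁ = *-cancelˡ K≢0 (begin
          K * (fromℕ (d ℕ.∸ 1) * S₁)                            ≡⟨ solve 4 (λ c m n s → (c :* m) :* (n :* s) := (n :* c) :* (s :* m)) refl (binom N α) (M 1) (fromℕ (d ℕ.∸ 1)) S₁ ⟩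
          (fromℕ (d ℕ.∸ 1) * binom N α) * (S₁ * M 1)            ≡⟨ cong₂ _*_ ratio₁ M₂≡S₁M₁ ⟨
          (fromℕ (suc α) * binom N (suc α)) * M 2               ≡⟨ *-assoc _ _ _ ⟩
          fromℕ (suc α) * (binom N (suc α) * M 2)               ≡⟨ cong (fromℕ (suc α) *_) G-head₁ ⟩
          fromℕ (suc α) * (κ * (π ^ α * (fromℕ α * T₁)))        ≡⟨ solve 5 (λ a k P n s → a :* (k :* (P :* (n :* s))) := (k :* P) :* (a :* n :* s)) refl (fromℕ (suc α)) κ (π ^ α) (fromℕ α) T₁ ⟩
          (κ * π ^ α) * (fromℕ (suc α) * fromℕ α * T₁)          ≡⟨ cong (_* (fromℕ (suc α) * fromℕ α * T₁)) G-head₀ ⟨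
          K * (fromℕ (suc α) * fromℕ α * T₁)                    ∎)
          where open ≡-Reasoning

        cleared₂ : fromℕ (d ℕ.∸ 1) * fromℕ (d ℕ.∸ 2) * (S₁ * S₁ + S₂)
                   ≡ fromℕ (suc α) * fromℕ (suc (suc α)) * ((fromℕ α * T₁) * (fromℕ α * T₁) - fromℕ α * T₂)
        cleared₂ = *-cancelˡ K≢0 (begin
          K * (fromℕ (d ℕ.∸ 1) * fromℕ (d ℕ.∸ 2) * S)
            ≡⟨ solve 5 (λ c m x y z → (c :* m) :* (x :* y :* z) := y :* (x :* c) :* (z :* m)) refl (binom N α) (M 1) (fromℕ (d ℕ.∸ 1)) (fromℕ (d ℕ.∸ 2)) S ⟩
          fromℕ (d ℕ.∸ 2) * (fromℕ (d ℕ.∸ 1) * binom N α) * (S * M 1)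
            ≡⟨ cong₂ (λ x y → fromℕ (d ℕ.∸ 2) * x * y) ratio₁ 2M₃≡[S₁²+S₂]M₁ ⟨
          fromℕ (d ℕ.∸ 2) * (fromℕ (suc α) * binom N (suc α)) * (two * M 3)
            ≡⟨ solve 5 (λ y a c t m → y :* (a :* c) :* (t :* m) := a :* (y :* c) :* (t :* m)) refl (fromℕ (d ℕ.∸ 2)) (fromℕ (suc α)) (binom N (suc α)) two (M 3) ⟩
          fromℕ (suc α) * (fromℕ (d ℕ.∸ 2) * binom N (suc α)) * (two * M 3)
            ≡⟨ cong (λ x → fromℕ (suc α) * x * (two * M 3)) ratio₂ ⟨
          fromℕ (suc α) * (fromℕ (suc (suc α)) * binom N (suc (suc α))) * (two * M 3)
            ≡⟨ solve 5 (λ a b c t m → a :* (b :* c) :* (t :* m) := a :* b :* (t :* (c :* m))) refl (fromℕ (suc α)) (fromℕ (suc (suc α))) (binom N (suc (suc α))) two (M 3) ⟩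
          fromℕ (suc α) * fromℕ (suc (suc α)) * (two * (binom N (suc (suc α)) * M 3))
            ≡⟨ cong (fromℕ (suc α) * fromℕ (suc (suc α)) *_) G-head₂ ⟩
          fromℕ (suc α) * fromℕ (suc (suc α)) * (κ * (π ^ α * Z))
            ≡⟨ solve 5 (λ a b k P z → a :* b :* (k :* (P :* z)) := (k :* P) :* (a :* b :* z)) refl (fromℕ (suc α)) (fromℕ (suc (suc α))) κ (π ^ α) Z ⟩
          (κ * π ^ α) * (fromℕ (suc α) * fromℕ (suc (suc α)) * Z)
            ≡⟨ cong (_* (fromℕ (suc α) * fromℕ (suc (suc α)) * Z)) G-head₀ ⟨
          K * (fromℕ (suc α) * fromℕ (suc (suc α)) * Z) ∎)
          where
          open ≡-Reasoning
          S = S₁ * S₁ + S₂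
          Z = (fromℕ α * T₁) * (fromℕ α * T₁) - fromℕ α * T₂

        D₁≢0 : fromℕ (d ℕ.∸ 1) ≢ 0#
        D₁≢0 = fromℕ-≢0 (ℕ.∸-monoˡ-< (ℕ.≤-trans (s≤s (s≤s z≤n)) 4≤d) (s≤s z≤n)) (ℕ.m∸n≤m d 1)

        D₂≢0 : fromℕ (d ℕ.∸ 2) ≢ 0#
        D₂≢0 = fromℕ-≢0 (ℕ.∸-monoˡ-< (ℕ.≤-trans (s≤s (s≤s (s≤s z≤n))) 4≤d) (s≤s (s≤s z≤n))) (ℕ.m∸n≤m d 2)

      identity₁ : S₁ ≡ fromℕ ((α ℕ.+ 1) ℕ.* α) * inv (fromℕ (d ℕ.∸ 1)) * T₁
      identity₁ = begin
        S₁                                                   ≡⟨ x*y≡z⇒y≡inv[x]*z D₁≢0 cleared₁ ⟩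
        inv D * (fromℕ (suc α) * fromℕ α * T₁)               ≡⟨ solve 4 (λ i a b t → i :* (a :* b :* t) := a :* b :* i :* t) refl (inv D) (fromℕ (suc α)) (fromℕ α) T₁ ⟩
        fromℕ (suc α) * fromℕ α * inv D * T₁                 ≡⟨ cong (λ x → x * inv D * T₁) (fromℕ-* (suc α) α) ⟨
        fromℕ (suc α ℕ.* α) * inv D * T₁                     ≡⟨ cong (λ n → fromℕ (n ℕ.* α) * inv D * T₁) (ℕ.+-comm 1 α) ⟩
        fromℕ ((α ℕ.+ 1) ℕ.* α) * inv D * T₁                 ∎
        where
        open ≡-Reasoning
        D = fromℕ (d ℕ.∸ 1)

      identity₂ : S₁ * S₁ + S₂ ≡ fromℕ (α ℕ.* (α ℕ.+ 1) ℕ.* (α ℕ.+ 2)) * inv (fromℕ ((d ℕ.∸ 1) ℕ.* (d ℕ.∸ 2))) * (fromℕ α * (T₁ * T₁) - T₂)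
      identity₂ = begin
        S₁ * S₁ + S₂
          ≡⟨ x*y≡z⇒y≡inv[x]*z (subst (_≢ 0#) (sym (fromℕ-* (d ℕ.∸ 1) (d ℕ.∸ 2))) (x*y≢0 D₁≢0 D₂≢0))
                              (trans (cong (_* (S₁ * S₁ + S₂)) (fromℕ-* (d ℕ.∸ 1) (d ℕ.∸ 2))) cleared₂) ⟩
        inv D * (fromℕ (suc α) * fromℕ (suc (suc α)) * ((fromℕ α * T₁) * (fromℕ α * T₁) - fromℕ α * T₂))
          ≡⟨ solve 6 (λ i a b c t u → i :* (b :* c :* ((a :* t) :* (a :* t) :- a :* u)) := a :* b :* c :* i :* (a :* (t :* t) :- u))
               refl (inv D) (fromℕ α) (fromℕ (suc α)) (fromℕ (suc (suc α))) T₁ T₂ ⟩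
        fromℕ α * fromℕ (suc α) * fromℕ (suc (suc α)) * inv D * (fromℕ α * (T₁ * T₁) - T₂)
          ≡⟨ cong (λ x → x * inv D * (fromℕ α * (T₁ * T₁) - T₂)) (sym α[α+1][α+2]) ⟩
        fromℕ (α ℕ.* (α ℕ.+ 1) ℕ.* (α ℕ.+ 2)) * inv D * (fromℕ α * (T₁ * T₁) - T₂) ∎
        where
        open ≡-Reasoning
        D = fromℕ ((d ℕ.∸ 1) ℕ.* (d ℕ.∸ 2))
        α[α+1][α+2] : fromℕ (α ℕ.* (α ℕ.+ 1) ℕ.* (α ℕ.+ 2)) ≡ fromℕ α * fromℕ (suc α) * fromℕ (suc (suc α))
        α[α+1][α+2] = begin
          fromℕ (α ℕ.* (α ℕ.+ 1) ℕ.* (α ℕ.+ 2))                 ≡⟨ cong₂ (λ m n → fromℕ (α ℕ.* m ℕ.* n)) (ℕ.+-comm α 1) (ℕ.+-comm α 2) ⟩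
          fromℕ (α ℕ.* suc α ℕ.* suc (suc α))                   ≡⟨ fromℕ-* (α ℕ.* suc α) (suc (suc α)) ⟩
          fromℕ (α ℕ.* suc α) * fromℕ (suc (suc α))             ≡⟨ cong (_* fromℕ (suc (suc α))) (fromℕ-* α (suc α)) ⟩
          fromℕ α * fromℕ (suc α) * fromℕ (suc (suc α))         ∎

open import Defs
open import Data.Nat as ℕ using (ℕ; zero; suc; _∸_; _<_; _≤_; z≤n; s≤s; NonZero)
import Data.Nat.Properties as ℕ
open import Data.Nat.Divisibility using (_∣_; divides)
open import Data.Nat.Primality using (Prime; prime⇒nonTrivial)
open import Data.Fin using (Fin; toℕ)
open import Data.Fin.Properties using (toℕ-injective; toℕ<n)
open import Data.List using (List; []; _∷_; length; map; tabulate; cartesianProductWith)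
import Data.List.Properties as List
open import Data.List.Membership.Propositional using (_∈_)
open import Data.List.Membership.Propositional.Properties using (∈-map⁻; ∈-cartesianProductWith⁺; ∈-tabulate⁻)
open import Data.List.Relation.Unary.All as All using (All)
open import Data.List.Relation.Unary.Unique.Propositional using (Unique)
import Data.List.Relation.Unary.Unique.Propositional.Properties as Unique
open import Data.Product using (_×_; _,_; ∃-syntax)
open import Data.Empty using (⊥-elim)
open import Function using (_∘_)
open import Function.Bundles using (_⇔_; Equivalence)
open import Relation.Binary.PropositionalEquality

import Algebra.Bundles
open Rings using (CommRing; module Solver)

length-cartesianProductWith : ∀ {A B C : Set} (f : A → B → C) xs ys →
                              length (cartesianProductWith f xs ys) ≡ length xs ℕ.* length ys
length-cartesianProductWith f [] ys = refl
length-cartesianProductWith f (x ∷ xs) ys = trans (List.length-++ (map (f x) ys))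
  (cong₂ ℕ._+_ (List.length-map (f x) ys) (length-cartesianProductWith f xs ys))

d∣n∧d<n⇒2d≤n : ∀ {d n} → d ∣ n → d < n → 2 ℕ.* d ≤ n
d∣n∧d<n⇒2d≤n {d} (divides zero refl) d<0 = ⊥-elim (ℕ.n≮0 d<0)
d∣n∧d<n⇒2d≤n {d} (divides (suc zero) refl) d<d+0 = ⊥-elim (ℕ.<-irrefl (sym (ℕ.+-identityʳ d)) d<d+0)
d∣n∧d<n⇒2d≤n {d} (divides (suc (suc q)) refl) _ = ℕ.*-monoˡ-≤ d {2} {suc (suc q)} (s≤s (s≤s z≤n))

module PrimeFieldSumset (p : ℕ) .{{_ : NonZero p}} (p-prime : Prime p)
             (d : ℕ) (d∣p∸1 : d ∣ p ∸ 1) (1<d : 1 < d) (d<p∸1 : d < p ∸ 1)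
             (a₀ : Fin p) (A₀ B : List (Fin p)) (unique-A : Unique (a₀ ∷ A₀)) (unique-B : Unique B)
             (sumset : ∀ x → IsRootOfUnity p d x ⇔ (∃[ a ] ∃[ b ] (a ∈ a₀ ∷ A₀ × b ∈ B × x ≡ _+F_ p a b)))
             (0<α′ : 0 < length A₀) (1<β : 1 < length B) {b : Fin p} (b∈B : b ∈ B) where

  p>1 : 1 < p
  p>1 = ℕ.nonTrivial⇒n>1 p {{prime⇒nonTrivial p-prime}}

  open PrimeField p p>1
  open CommRing 𝔽
  open Solver 𝔽 using (fromℕ)
  open import Algebra.Properties.Group (Algebra.Bundles.CommutativeRing.+-group commutativeRing)
    using (∙-cancelʳ; ⁻¹-injective; ⁻¹-involutive)
  open Polynomials 𝔽 using (_^_)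
  open PolynomialsOverFields (𝔽-field p-prime) using (rootsOfUnity-bound; rootsOfUnity-lowerBound; sum)

  A = a₀ ∷ A₀
  α = length A

  0<d : 0 < d
  0<d = ℕ.<-trans (s≤s z≤n) 1<d

  rootOfUnity : ∀ {a b} → a ∈ A → b ∈ B → (a + b) ^ d ≡ 1#
  rootOfUnity {a} {b} a∈A b∈B = trans (sym (^F≡^ (a + b) d)) (Equivalence.from (sumset (a + b)) (a , b , a∈A , b∈B , refl))

  α≤d : α ≤ d
  α≤d = subst (_≤ d) (List.length-map (_+ b) A)
    (rootsOfUnity-bound 0<d (Unique.map⁺ (∙-cancelʳ b _ _) unique-A) (All.tabulate roots))
    where
    roots : ∀ {x} → x ∈ map (_+ b) A → x ^ d ≡ 1#
    roots x∈ with ∈-map⁻ (_+ b) x∈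
    ... | a , a∈A , refl = rootOfUnity a∈A b∈B

  d+α≤p∸1 : d ℕ.+ α ≤ p ∸ 1
  d+α≤p∸1 = ℕ.≤-trans (ℕ.+-monoʳ-≤ d α≤d) (subst (_≤ p ∸ 1) (cong (d ℕ.+_) (ℕ.+-identityʳ d)) (d∣n∧d<n⇒2d≤n d∣p∸1 d<p∸1))

  char : ∀ {n} → 0 < n → n ≤ d ℕ.+ length (map -_ A₀) → fromℕ n ≢ 0#
  char {n} 0<n n≤d+α′ = fromℕ-≢0 0<n (begin-strict
    n                            ≤⟨ n≤d+α′ ⟩
    d ℕ.+ length (map -_ A₀)     ≡⟨ cong (d ℕ.+_) (List.length-map -_ A₀) ⟩
    d ℕ.+ length A₀              <⟨ ℕ.+-monoʳ-< d (ℕ.n<1+n _) ⟩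
    d ℕ.+ α                      ≤⟨ d+α≤p∸1 ⟩
    p ∸ 1                      <⟨ ℕ.∸-monoʳ-< (s≤s z≤n) (ℕ.<⇒≤ p>1) ⟩
    p                          ∎)
    where open ℕ.≤-Reasoning

  b-[-a]≡a+b : ∀ a b → b - (- a) ≡ a + b
  b-[-a]≡a+b a b = trans (cong (b +_) (⁻¹-involutive a)) (+-comm b a)

  roots : ∀ {c b} → c ∈ map -_ A → b ∈ B → (b - c) ^ d ≡ 1#
  roots {b = b} c∈ b∈B with ∈-map⁻ -_ c∈
  ... | a , a∈A , refl = trans (cong (_^ d) (b-[-a]≡a+b a b)) (rootOfUnity a∈A b∈B)

  nonzero : List (Fin p)
  nonzero = tabulate (λ (i : Fin (p ∸ 1)) → ι p (suc (toℕ i)))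

  toℕ-nonzero : ∀ (i : Fin (p ∸ 1)) → toℕ (ι p (suc (toℕ i))) ≡ suc (toℕ i)
  toℕ-nonzero i = toℕ-ι-< (ℕ.<-≤-trans (s≤s (toℕ<n i)) (ℕ.≤-reflexive (ℕ.m+[n∸m]≡n (ℕ.<⇒≤ p>1))))

  unique-nonzero : Unique nonzero
  unique-nonzero = Unique.tabulate⁺ λ {i} {j} eq →
    toℕ-injective (ℕ.suc-injective (trans (sym (toℕ-nonzero i)) (trans (cong toℕ eq) (toℕ-nonzero j))))

  nonzero-≢0 : ∀ {u} → u ∈ nonzero → u ≢ 0#
  nonzero-≢0 u∈ u≡0 with ∈-tabulate⁻ u∈
  ... | i , refl = ℕ.1+n≢0 (trans (sym (toℕ-nonzero i)) (trans (cong toℕ u≡0) toℕ-0F))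

  -- The d-th roots of unity all lie in A + B, and there are d of them.
  d≤αβ : d ≤ length (map -_ A) ℕ.* length B
  d≤αβ = from-divisibility d∣p∸1
    where
    covered : ∀ {u} → ∃[ a ] ∃[ b ] (a ∈ A × b ∈ B × u ≡ a + b) → u ∈ cartesianProductWith _+_ A B
    covered (a , b , a∈A , b∈B , refl) = ∈-cartesianProductWith⁺ _+_ a∈A b∈B
    from-divisibility : d ∣ p ∸ 1 → d ≤ length (map -_ A) ℕ.* length B
    from-divisibility (divides zero p∸1≡0) = ⊥-elim (ℕ.n≮0 (subst (d <_) p∸1≡0 d<p∸1))
    from-divisibility (divides (suc k) p∸1≡[1+k]d) =
      subst (d ≤_) (trans (length-cartesianProductWith _+_ A B) (cong (ℕ._* length B) (sym (List.length-map -_ A))))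
        (rootsOfUnity-lowerBound k 0<d unique-nonzero (trans (List.length-tabulate _) p∸1≡[1+k]d)
          (All.tabulate λ {u} u∈ → subst (λ n → u ^ n ≡ 1#) p∸1≡[1+k]d (fermat p-prime (nonzero-≢0 u∈)))
          (All.tabulate λ {u} _ u^d≡1 → covered (Equivalence.to (sumset u) (trans (^F≡^ u d) u^d≡1))))

  open Sumsets (𝔽-field p-prime)
  open RootsOfUnity d (- a₀) (map -_ A₀) B
    (Unique.map⁺ ⁻¹-injective unique-A) unique-B (subst (0 <_) (sym (List.length-map -_ A₀)) 0<α′) 1<β 0<d roots char d≤αβ
    using (identity₁; identity₂)

  S₁ S₂ T₁ T₂ : Fin p
  S₁ = sumF p (map (λ a → invF p (_+F_ p a b)) A)
  S₂ = sumF p (map (λ a → invF p (sqF p (_+F_ p a b))) A)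
  T₁ = sumF p (map (λ b′ → invF p (_-F_ p b b′)) (remove p b B))
  T₂ = sumF p (map (λ b′ → invF p (sqF p (_-F_ p b b′))) (remove p b B))

  private

    sum-C : ∀ (f : Fin p → Fin p) → sum (map (λ l → f (b - l)) (map -_ A)) ≡ sumF p (map (λ a → f (a + b)) A)
    sum-C f = cong sum (trans (sym (List.map-∘ A)) (List.map-cong (λ a → cong f (b-[-a]≡a+b a b)) A))

    fromℕ-α : ∀ (f : ℕ → ℕ) → fromℕ (f (length (map -_ A))) ≡ ι p (f α)
    fromℕ-α f = trans (cong (fromℕ ∘ f) (List.length-map -_ A)) (fromℕ≡ι (f α))

  first-identity : S₁ ≡ _*F_ p (_*F_ p (ι p ((α ℕ.+ 1) ℕ.* α)) (invF p (ι p (d ∸ 1)))) T₁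
  first-identity = begin
    S₁                                                                          ≡⟨ sum-C (invF p) ⟨
    _                                                                           ≡⟨ identity₁ b∈B ⟩
    _                                                                           ≡⟨ cong₂ (λ x y → x * invF p y * T₁) (fromℕ-α (λ α → (α ℕ.+ 1) ℕ.* α)) (fromℕ≡ι (d ∸ 1)) ⟩
    ι p ((α ℕ.+ 1) ℕ.* α) * invF p (ι p (d ∸ 1)) * T₁                          ∎
    where open ≡-Reasoning

  second-identity : _+F_ p (sqF p S₁) S₂
                    ≡ _*F_ p (_*F_ p (ι p (α ℕ.* (α ℕ.+ 1) ℕ.* (α ℕ.+ 2))) (invF p (ι p ((d ∸ 1) ℕ.* (d ∸ 2)))))
                             (_-F_ p (_*F_ p (ι p α) (sqF p T₁)) T₂)
  second-identity = begin
    _ ≡⟨ cong₂ (λ x y → x * x + y) (sum-C (invF p)) (sum-C (λ e → invF p (e * e))) ⟨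
    _ ≡⟨ identity₂ b∈B ⟩
    _ ≡⟨ cong₂ (λ x y → x * invF p y * (fromℕ (length (map -_ A)) * (T₁ * T₁) - T₂))
               (fromℕ-α (λ α → α ℕ.* (α ℕ.+ 1) ℕ.* (α ℕ.+ 2))) (fromℕ≡ι ((d ∸ 1) ℕ.* (d ∸ 2))) ⟩
    _ ≡⟨ cong (λ z → ι p (α ℕ.* (α ℕ.+ 1) ℕ.* (α ℕ.+ 2)) * invF p (ι p ((d ∸ 1) ℕ.* (d ∸ 2))) * (z * (T₁ * T₁) - T₂))
              (fromℕ-α (λ α → α)) ⟩
    _ ∎
    where open ≡-Reasoning

open import Data.Nat using (_+_; _*_)

lemma10 : (p : ℕ) .{{_ : NonZero p}} → Prime p →
          (d : ℕ) → d ∣ p ∸ 1 → 1 < d → d < p ∸ 1 →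
          (A B : List (Fin p)) → Unique A → Unique B →
          (∀ (x : Fin p) → IsRootOfUnity p d x ⇔ (∃[ a ] ∃[ b ] (a ∈ A × b ∈ B × x ≡ _+F_ p a b))) →
          1 < length A → 1 < length B →
          ∀ (b : Fin p) → b ∈ B →
          let α = length A
              S1 = sumF p (map (λ a → invF p (_+F_ p a b)) A)
              S2 = sumF p (map (λ a → invF p (sqF p (_+F_ p a b))) A)
              T1 = sumF p (map (λ b′ → invF p (_-F_ p b b′)) (remove p b B))
              T2 = sumF p (map (λ b′ → invF p (sqF p (_-F_ p b b′))) (remove p b B))
          in (S1 ≡ _*F_ p (_*F_ p (ι p ((α + 1) * α)) (invF p (ι p (d ∸ 1)))) T1)
             × (_+F_ p (sqF p S1) S2
                ≡ _*F_ p (_*F_ p (ι p (α * (α + 1) * (α + 2))) (invF p (ι p ((d ∸ 1) * (d ∸ 2)))))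
                         (_-F_ p (_*F_ p (ι p α) (sqF p T1)) T2))
lemma10 p p-prime d d∣p∸1 1<d d<p∸1 [] B _ _ _ () _ _ _
lemma10 p p-prime d d∣p∸1 1<d d<p∸1 (a₀ ∷ A₀) B unique-A unique-B sumset (s≤s 0<α′) 1<β b b∈B = first-identity , second-identity
  where open PrimeFieldSumset p p-prime d d∣p∸1 1<d d<p∸1 a₀ A₀ B unique-A unique-B sumset 0<α′ 1<β b∈B
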